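{- Let $\mathcal M\subset\mathbb Z^2$ be a minimal subgraph. Let $x_0\sim x_1\sim\cdots\sim x_m$ be a finite non-closed simple path with all vertices in $\mathcal M$, lying in one closed half-plane bounded by a horizontal or vertical line $\ell$, with both endpoints $x_0,x_m$ on $\ell$. Then every lattice point of the region enclosed by $\ell$ and the path belongs to $\mathcal M$.
   Context: $\mathbb Z^2$ is the integer lattice graph ($x\sim y$ iff $|x-y|=1$), embedded in $\mathbb R^2$ with edges as unit segments. For $\Omega\subset\mathbb Z^2$: $\tau\Omega=\{z\notin\Omega:\exists w\in\Omega,z\sim w\}$, $\overline\Omega=\Omega\cup\tau\Omega$, $E_\Omega$ = edges $\{x,y\}$ with $x\in\Omega,y\in\overline\Omega$, $\partial K$ = edges with exactly one endpoint in $K$. A proper nonempty $\mathcal M\subset\mathbb Z^2$ is minimal if for every finite $U$ and every $\hat K\subset\overline U$ with $\hat K\cap\tau U=\mathcal M\cap\tau U$, $|\partial\mathcal M\cap E_U|\le|\partial\hat K\cap E_U|$. A path is simple if its vertices are pairwise distinct. -}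

module Defs where

open import Data.Bool using (Bool; true; false; _∧_; _∨_; _xor_; not; if_then_else_)
open import Data.Integer as ℤ using (ℤ; +_; _+_; _-_; _*_; _≤_; _≤ᵇ_; ∣_∣)
open import Data.Nat as ℕ using (ℕ; zero; suc)
open import Data.Fin using (Fin; zero; suc; inject₁; fromℕ)
open import Data.List using (List; []; _∷_; _++_; map; filter; length; concatMap; deduplicate; zip; foldr; upTo; tabulate)
open import Data.List.Membership.Propositional using (_∈_)
open import Data.Product using (_×_; _,_; proj₁; proj₂; ∃)
open import Data.Product.Properties using (≡-dec)
open import Data.Sum using (_⊎_)
open import Relation.Nullary using (¬_; does)
open import Relation.Binary.PropositionalEquality using (_≡_)
import Data.Bool.Properties as BoolP

Point : Set
Point = ℤ × ℤ

_∼_ : Point → Point → Set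
(a , b) ∼ (c , d) = (a - c) * (a - c) + (b - d) * (b - d) ≡ + 1

infix 4 _==_
_==_ : ℤ → ℤ → Bool
a == b = does (a ℤ.≟ b)

-- Finite sets U ⊂ Z^2 are given as lists (duplicates allowed);
-- subsets M, K ⊂ Z^2 are given by characteristic functions Point → Bool.

_∈τ_ : Point → List Point → Set
z ∈τ U = ¬ (z ∈ U) × ∃ (λ w → w ∈ U × z ∼ w)

_∈cl_ : Point → List Point → Set
z ∈cl U = z ∈ U ⊎ z ∈τ U

-- Edges of Z^2.  Every edge is uniquely written as (p , true) = {p, p+(1,0)}
-- (horizontal) or (p , false) = {p, p+(0,1)} (vertical).

Edge : Set
Edge = Point × Bool

endpoints : Edge → Point × Point
endpoints ((a , b) , true)  = (a , b) , (a + + 1 , b)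
endpoints ((a , b) , false) = (a , b) , (a , b + + 1)

incident : Point → List Edge
incident (a , b) =
  ((a , b) , true) ∷ ((a , b) , false) ∷
  ((a - + 1 , b) , true) ∷ ((a , b - + 1) , false) ∷ []

edge-≟ : (e f : Edge) → Relation.Nullary.Dec (e ≡ f)
edge-≟ = ≡-dec (≡-dec ℤ._≟_ ℤ._≟_) BoolP._≟_

-- E_U as a duplicate-free list: the edges {x,y} with x ∈ U (then y ∈ Ū
-- automatically, since every neighbour of a point of U lies in Ū).
E : List Point → List Edge
E U = deduplicate edge-≟ (concatMap incident U)

inBoundary : (Point → Bool) → Edge → Bool
inBoundary K e = K (proj₁ (endpoints e)) xor K (proj₂ (endpoints e))

boundaryCount : (Point → Bool) → List Point → ℕ
boundaryCount K U = length (filter (λ e → Data.Bool.T? (inBoundary K e)) (E U))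

Minimal : (Point → Bool) → Set
Minimal M =
  ∃ (λ z → M z ≡ true) × ∃ (λ z → M z ≡ false) ×
  ((U : List Point) (K : Point → Bool) →
     (∀ z → K z ≡ true → z ∈cl U) →
     (∀ z → z ∈τ U → K z ≡ M z) →
     boundaryCount M U ℕ.≤ boundaryCount K U)

-- Closed half-planes bounded by a horizontal or vertical line ℓ.
-- (side , c):  up   : ℓ = {y = c}, half-plane y ≥ c
--              down : ℓ = {y = c}, half-plane y ≤ c
--              right: ℓ = {x = c}, half-plane x ≥ c
--              left : ℓ = {x = c}, half-plane x ≤ c

data Side : Set where
  up down right left : Side

offset : Side → ℤ → Point → ℤ
offset up    c (x , y) = y - c
offset down  c (x , y) = c - y
offset right c (x , y) = x - c
offset left  c (x , y) = c - x

strictlyBetween : ℤ → ℤ → List ℤ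
strictlyBetween a b =
  if a ≤ᵇ b
  then map (λ k → a + + suc k) (upTo (ℕ.pred ∣ b - a ∣))
  else map (λ k → a - + suc k) (upTo (ℕ.pred ∣ b - a ∣))

segmentBetween : Side → ℤ → Point → Point → List Point
segmentBetween up    c p q = map (λ t → (t , c)) (strictlyBetween (proj₁ p) (proj₁ q))
segmentBetween down  c p q = map (λ t → (t , c)) (strictlyBetween (proj₁ p) (proj₁ q))
segmentBetween right c p q = map (λ t → (c , t)) (strictlyBetween (proj₂ p) (proj₂ q))
segmentBetween left  c p q = map (λ t → (c , t)) (strictlyBetween (proj₂ p) (proj₂ q))

curve : Side → ℤ → (m : ℕ) → (Fin (suc m) → Point) → List Point
curve s c m x = tabulate x ++ segmentBetween s c (x (fromℕ m)) (x zero)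

cyclicPairs : List Point → List (Point × Point)
cyclicPairs []       = []
cyclicPairs (w ∷ ws) = zip (w ∷ ws) (ws ++ w ∷ [])

-- does the unit segment p q cross the ray {(t , b + 1/2) : t > a} issued
-- (just above) from z = (a , b) ?
crossesRay : Point → Point × Point → Bool
crossesRay (a , b) ((px , py) , (qx , qy)) =
  (px == qx) ∧ not (px ≤ᵇ a) ∧
  (((py == b) ∧ (qy == b + + 1)) ∨ ((qy == b) ∧ (py == b + + 1)))

-- parity of the number of crossings (odd ⇒ z lies inside the curve)
crossingParity : Point → List Point → Bool
crossingParity z W = foldr _xor_ false (map (crossesRay z) (cyclicPairs W))

Enclosed : Side → ℤ → (m : ℕ) → (Fin (suc m) → Point) → Point → Set
Enclosed s c m x z = z ∈ curve s c m x ⊎ crossingParity z (curve s c m x) ≡ true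

-- Let R be the enclosed region, described by the parity of crossings of a horizontal ray
-- with the closed curve W formed by the path and the segment of ℓ between its ends. If
-- R ⊄ M, compare M with K̂ = (M ∪ R) ∩ Ū for a box U ⊇ R: minimality gives at least as many
-- edges in ∂M ∖ ∂K̂ as in ∂K̂ ∖ ∂M. Crossing parity only changes across edges of W, so an edge
-- of ∂K̂ ∖ ∂M leaves R from a point u of ℓ off the path (the path lies in M), in the one
-- normal direction that leads out of R. Marching from u the other way through R ∖ M until M is
-- reached gives an edge of ∂M ∖ ∂K̂ in the column of u, injectively; marching parallel to ℓ
-- from a point of R ∖ M gives one more such edge, parallel to ℓ, contradicting minimality.

module Submission where

open import Defs
open import Algebra.Bundles using (CommutativeRing; CommutativeMonoid)
open import Data.Bool using (Bool; true; false; _∧_; _∨_; _xor_; not; if_then_else_)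
open import Data.Bool.Properties
  using ( xor-assoc; xor-comm; xor-same; xor-identityʳ; xor-annihilates-not; xor-∧-commutativeRing
        ; ∧-distribʳ-xor; ∧-identityʳ; ∧-idem; ∧-zeroʳ; ∨-identityʳ; ∨-zeroʳ; ∨-comm; T-≡)
open import Algebra.Properties.CommutativeSemigroup
  (CommutativeMonoid.commutativeSemigroup (CommutativeRing.+-commutativeMonoid xor-∧-commutativeRing))
  using (interchange)
open import Data.Empty using (⊥-elim)
open import Data.Fin using (Fin; zero; inject₁; fromℕ) renaming (suc to fsuc)
open import Data.Integer as ℤ using (ℤ; +_; -[1+_]; _+_; _-_; _*_; _≤_; _<_; _>_; _≤ᵇ_; ∣_∣; +≤+; -≤-; -≤+)
import Data.Integer.Properties as ℤP
open import Data.Integer.Tactic.RingSolver using (solve-∀)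
open import Data.List
  using (List; []; _∷_; _++_; map; filter; length; foldr; zip; upTo; applyUpTo; tabulate; cartesianProduct; concatMap)
open import Data.List.Membership.Propositional using (_∈_; _∉_; find)
open import Data.List.Membership.Propositional.Properties
  using ( ∈-∃++; ∈-++⁻; ∈-++⁺ˡ; ∈-++⁺ʳ; ∈-map⁻; ∈-map⁺; ∈-upTo⁺; ∈-cartesianProduct⁺; ∈-tabulate⁺; ∈-tabulate⁻
        ; ∈-concatMap⁺; ∈-concatMap⁻; ∈-deduplicate⁺; ∈-deduplicate⁻; ∈-filter⁺; ∈-filter⁻)
open import Data.List.Properties using (length-++; length-map; ++-assoc; map-++; map-upTo)
open import Data.List.Relation.Binary.Subset.Propositional using (_⊆_)
open import Data.List.Relation.Unary.All using (All)
import Data.List.Relation.Unary.All as All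
import Data.List.Relation.Unary.All.Properties as All
open import Data.List.Relation.Unary.AllPairs using ([]; _∷_)
open import Data.List.Relation.Unary.Any as Any using (Any; here; there; any?)
open import Data.List.Relation.Unary.Unique.Propositional using (Unique)
import Data.List.Relation.Unary.Unique.Propositional.Properties as Unique
open import Data.List.Relation.Unary.Unique.DecPropositional.Properties edge-≟ using (deduplicate-!)
open import Data.Nat as ℕ using (ℕ; zero; suc; s≤s; z≤n)
import Data.Nat.Properties as ℕP
open import Data.Product using (_×_; _,_; proj₁; proj₂; ∃; ∃₂)
open import Data.Product.Properties using (≡-dec)
open import Data.Sum using (_⊎_; inj₁; inj₂; [_,_]′)
open import Function using (_∘_)
open import Function.Bundles using (Equivalence)
open import Function.Definitions using (Injective)
open import Relation.Binary.Definitions using (DecidableEquality; tri<; tri≈; tri>)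
open import Relation.Binary.PropositionalEquality
open import Relation.Nullary using (¬_; Dec; does; yes; no; contradiction)
open import Relation.Nullary.Decidable using (dec-true; dec-false; decidable-stable)
open import Relation.Nullary.Decidable.Core using (T?; toSum)

-- Parities and counts along lists

private
  variable
    A B : Set

flips : (A → Bool) → A × A → Bool
flips G (p , q) = G p xor G q

parity : (A → Bool) → List A → Bool
parity h xs = foldr _xor_ false (map h xs)

parity-++ : ∀ (h : A → Bool) xs ys → parity h (xs ++ ys) ≡ parity h xs xor parity h ys
parity-++ h []       ys = refl
parity-++ h (x ∷ xs) ys = trans (cong (h x xor_) (parity-++ h xs ys)) (sym (xor-assoc (h x) _ _))

parity-xor : ∀ (h k : A → Bool) xs → parity (λ a → h a xor k a) xs ≡ parity h xs xor parity k xs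
parity-xor h k []       = refl
parity-xor h k (x ∷ xs) =
  trans (cong ((h x xor k x) xor_) (parity-xor h k xs)) (interchange (h x) (k x) _ _)

parity-cong : ∀ {h k : A → Bool} xs → (∀ {a} → a ∈ xs → h a ≡ k a) → parity h xs ≡ parity k xs
parity-cong []       h≗k = refl
parity-cong (x ∷ xs) h≗k = cong₂ _xor_ (h≗k (here refl)) (parity-cong xs (h≗k ∘ there))

parity-allFalse : ∀ {h : A → Bool} xs → (∀ {a} → a ∈ xs → h a ≡ false) → parity h xs ≡ false
parity-allFalse []       h≡false = refl
parity-allFalse (x ∷ xs) h≡false
  rewrite h≡false (here refl) = parity-allFalse xs (λ a∈xs → h≡false (there a∈xs))

parity-map : ∀ (h : B → Bool) (f : A → B) xs → parity h (map f xs) ≡ parity (λ a → h (f a)) xs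
parity-map h f []       = refl
parity-map h f (x ∷ xs) = cong (h (f x) xor_) (parity-map h f xs)

parity-true⇒Any : ∀ (h : A → Bool) xs → parity h xs ≡ true → Any (λ a → h a ≡ true) xs
parity-true⇒Any h (x ∷ xs) odd with h x in hx
... | true  = here hx
... | false = there (parity-true⇒Any h xs odd)

xor≡true-cases : ∀ {a b} → (a xor b) ≡ true → (a ≡ true × b ≡ false) ⊎ (a ≡ false × b ≡ true)
xor≡true-cases {true}  {false} _ = inj₁ (refl , refl)
xor≡true-cases {false} {true}  _ = inj₂ (refl , refl)

∨≡true⇒⊎ : ∀ {a b} → (a ∨ b) ≡ true → a ≡ true ⊎ b ≡ true
∨≡true⇒⊎ {true}  _  = inj₁ refl
∨≡true⇒⊎ {false} eq = inj₂ eq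

does≡true⇒ : ∀ {P : Set} (P? : Dec P) → does P? ≡ true → P
does≡true⇒ (yes p) _ = p

consecutive : List A → List (A × A)
consecutive []           = []
consecutive (a ∷ [])     = []
consecutive (a ∷ b ∷ xs) = (a , b) ∷ consecutive (b ∷ xs)

∈-consecutive⁻ : ∀ xs {e : A × A} → e ∈ consecutive xs → proj₁ e ∈ xs × proj₂ e ∈ xs
∈-consecutive⁻ (a ∷ b ∷ xs) (here refl) = here refl , there (here refl)
∈-consecutive⁻ (a ∷ b ∷ xs) (there e∈) with ∈-consecutive⁻ (b ∷ xs) e∈
... | p∈ , q∈ = there p∈ , there q∈

consecutive-map : ∀ (g : A → B) xs →
  consecutive (map g xs) ≡ map (λ e → g (proj₁ e) , g (proj₂ e)) (consecutive xs)
consecutive-map g []           = refl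
consecutive-map g (a ∷ [])     = refl
consecutive-map g (a ∷ b ∷ xs) = cong ((g a , g b) ∷_) (consecutive-map g (b ∷ xs))

consecutive-++ : ∀ (a : A) xs b ys →
  consecutive (a ∷ xs ++ b ∷ ys) ≡ consecutive (a ∷ xs ++ b ∷ []) ++ consecutive (b ∷ ys)
consecutive-++ a []       b ys = refl
consecutive-++ a (x ∷ xs) b ys = cong ((a , x) ∷_) (consecutive-++ x xs b ys)

parity-flips-consecutive : ∀ (G : A → Bool) a xs b →
  parity (flips G) (consecutive (a ∷ xs ++ b ∷ [])) ≡ G a xor G b
parity-flips-consecutive G a []       b = xor-identityʳ _
parity-flips-consecutive G a (x ∷ xs) b = begin
  (G a xor G x) xor parity (flips G) (consecutive (x ∷ xs ++ b ∷ []))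
    ≡⟨ cong ((G a xor G x) xor_) (parity-flips-consecutive G x xs b) ⟩
  (G a xor G x) xor (G x xor G b)   ≡⟨ xor-assoc (G a) (G x) _ ⟩
  G a xor (G x xor (G x xor G b))   ≡⟨ cong (G a xor_) (sym (xor-assoc (G x) (G x) (G b))) ⟩
  G a xor ((G x xor G x) xor G b)   ≡⟨ cong (λ y → G a xor (y xor G b)) (xor-same (G x)) ⟩
  G a xor G b                       ∎
  where open ≡-Reasoning

zip-consecutive : ∀ (u : A) ws z → zip (u ∷ ws) (ws ++ z ∷ []) ≡ consecutive (u ∷ ws ++ z ∷ [])
zip-consecutive u []       z = refl
zip-consecutive u (v ∷ vs) z = cong ((u , v) ∷_) (zip-consecutive v vs z)

count : (A → Bool) → List A → ℕ
count h xs = length (filter (λ a → T? (h a)) xs)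

count-exchange : ∀ (h k : A → Bool) xs →
  count h xs ℕ.+ count (λ a → k a ∧ not (h a)) xs ≡ count k xs ℕ.+ count (λ a → h a ∧ not (k a)) xs
count-exchange h k []       = refl
count-exchange h k (x ∷ xs) with h x | k x | count-exchange h k xs
... | true  | true  | ih = cong suc ih
... | true  | false | ih = trans (cong suc ih) (sym (ℕP.+-suc _ _))
... | false | true  | ih = trans (ℕP.+-suc _ _) (cong suc ih)
... | false | false | ih = ih

Unique-⊆⇒length-≤ : ∀ {xs ys : List A} → Unique xs → xs ⊆ ys → length xs ℕ.≤ length ys
Unique-⊆⇒length-≤ {xs = []}     _            _     = z≤n
Unique-⊆⇒length-≤ {xs = x ∷ xs} (x∉xs ∷ uxs) xs⊆ys with ∈-∃++ (xs⊆ys (here refl))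
... | ys₁ , ys₂ , refl =
  ℕP.≤-trans (s≤s (Unique-⊆⇒length-≤ uxs xs⊆ys₁ys₂)) (ℕP.≤-reflexive length-split)
  where
  xs⊆ys₁ys₂ : xs ⊆ ys₁ ++ ys₂
  xs⊆ys₁ys₂ {z} z∈xs with ∈-++⁻ ys₁ (xs⊆ys (there z∈xs))
  ... | inj₁ z∈ys₁         = ∈-++⁺ˡ z∈ys₁
  ... | inj₂ (here refl)   = ⊥-elim (All.lookup x∉xs z∈xs refl)
  ... | inj₂ (there z∈ys₂) = ∈-++⁺ʳ ys₁ z∈ys₂
  length-split : suc (length (ys₁ ++ ys₂)) ≡ length (ys₁ ++ x ∷ ys₂)
  length-split = begin
    suc (length (ys₁ ++ ys₂))          ≡⟨ cong suc (length-++ ys₁) ⟩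
    suc (length ys₁ ℕ.+ length ys₂)    ≡⟨ sym (ℕP.+-suc (length ys₁) (length ys₂)) ⟩
    length ys₁ ℕ.+ length (x ∷ ys₂)    ≡⟨ sym (length-++ ys₁) ⟩
    length (ys₁ ++ x ∷ ys₂)            ∎
    where open ≡-Reasoning

Unique-map⁺ : ∀ (f : A → B) {xs} → (∀ {x y} → x ∈ xs → y ∈ xs → f x ≡ f y → x ≡ y) →
  Unique xs → Unique (map f xs)
Unique-map⁺ f {[]}     inj []           = []
Unique-map⁺ f {x ∷ xs} inj (x∉xs ∷ uxs) =
  All.map⁺ (All.tabulate (λ {y} y∈xs fx≡fy → All.lookup x∉xs y∈xs (inj (here refl) (there y∈xs) fx≡fy)))
  ∷ Unique-map⁺ f (λ x∈ y∈ → inj (there x∈) (there y∈)) uxs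

length-<-injection : ∀ (f : A → B) {xs ys y₀} → Unique xs →
  (∀ {x} → x ∈ xs → f x ∈ ys) → (∀ {x y} → x ∈ xs → y ∈ xs → f x ≡ f y → x ≡ y) →
  y₀ ∈ ys → (∀ {x} → x ∈ xs → f x ≢ y₀) → length xs ℕ.< length ys
length-<-injection f {xs} {ys} {y₀} uxs f∈ys inj y₀∈ys f≢y₀ =
  subst (λ n → suc n ℕ.≤ length ys) (length-map f xs)
    (Unique-⊆⇒length-≤ (y₀∉ ∷ Unique-map⁺ f inj uxs) image⊆ys)
  where
  y₀∉ : All (y₀ ≢_) (map f xs)
  y₀∉ = All.map⁺ (All.tabulate (λ x∈xs y₀≡fx → f≢y₀ x∈xs (sym y₀≡fx)))
  image⊆ys : y₀ ∷ map f xs ⊆ ys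
  image⊆ys (here refl) = y₀∈ys
  image⊆ys (there y∈)  with ∈-map⁻ f y∈
  ... | x , x∈xs , refl = f∈ys x∈xs

-- Integer comparisons and lattice steps

==-refl : ∀ a → (a == a) ≡ true
==-refl a = dec-true (a ℤ.≟ a) refl

==⇒≡ : ∀ {a b} → (a == b) ≡ true → a ≡ b
==⇒≡ {a} {b} a==b with a ℤ.≟ b
... | yes a≡b = a≡b
... | no  _   = contradiction a==b λ ()

≢⇒==-false : ∀ {a b} → a ≢ b → (a == b) ≡ false
≢⇒==-false {a} {b} = dec-false (a ℤ.≟ b)

≤⇒≤ᵇ : ∀ {a b} → a ≤ b → (a ≤ᵇ b) ≡ true
≤⇒≤ᵇ a≤b = Equivalence.to T-≡ (ℤP.≤⇒≤ᵇ a≤b)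

>⇒≤ᵇ-false : ∀ {a b} → b < a → (a ≤ᵇ b) ≡ false
>⇒≤ᵇ-false {a} {b} b<a with a ≤ᵇ b in eq
... | false = refl
... | true  = ⊥-elim (ℤP.<⇒≱ b<a (ℤP.≤ᵇ⇒≤ (Equivalence.from T-≡ eq)))

≤ᵇ-false⇒> : ∀ {a b} → (a ≤ᵇ b) ≡ false → b < a
≤ᵇ-false⇒> eq = ℤP.≰⇒> (λ a≤b → contradiction (trans (sym eq) (≤⇒≤ᵇ a≤b)) λ ())

a+1-1≡a : ∀ a → a + + 1 - + 1 ≡ a
a+1-1≡a = solve-∀

a-1+1≡a : ∀ a → a - + 1 + + 1 ≡ a
a-1+1≡a = solve-∀

a<a+1 : ∀ a → a < a + + 1
a<a+1 a = ℤP.suc[i]≤j⇒i<j (ℤP.≤-reflexive (ℤP.+-comm (+ 1) a))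

a-1<a : ∀ a → a - + 1 < a
a-1<a a = subst (a - + 1 <_) (a-1+1≡a a) (a<a+1 (a - + 1))

<⇒+1≤ : ∀ {a b} → a < b → a + + 1 ≤ b
<⇒+1≤ {a} {b} a<b = subst (_≤ b) (ℤP.+-comm (+ 1) a) (ℤP.i<j⇒suc[i]≤j a<b)

<+1⇒≤ : ∀ {a b} → a < b + + 1 → a ≤ b
<+1⇒≤ a<b+1 = ℤP.≮⇒≥ (λ b<a → ℤP.<⇒≱ a<b+1 (<⇒+1≤ b<a))

+1-injective : ∀ {a b} → a + + 1 ≡ b + + 1 → a ≡ b
+1-injective {a} {b} eq = trans (sym (a+1-1≡a a)) (trans (cong (_- + 1) eq) (a+1-1≡a b))

+1==+1 : ∀ a b → ((a + + 1) == (b + + 1)) ≡ (a == b)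
+1==+1 a b with a ℤ.≟ b
... | yes refl = ==-refl (a + + 1)
... | no  a≢b  = ≢⇒==-false (a≢b ∘ +1-injective)

≤ᵇ-xor-sucˡ : ∀ x p → ((x ≤ᵇ p) xor (x + + 1 ≤ᵇ p)) ≡ (x == p)
≤ᵇ-xor-sucˡ x p with ℤP.<-cmp x p
... | tri< x<p x≢p _ rewrite ≤⇒≤ᵇ (ℤP.<⇒≤ x<p) | ≤⇒≤ᵇ (<⇒+1≤ x<p) | ≢⇒==-false x≢p = refl
... | tri≈ _ refl _  rewrite ≤⇒≤ᵇ (ℤP.≤-refl {x}) | >⇒≤ᵇ-false (a<a+1 x) | ==-refl x = refl
... | tri> _ x≢p p<x
  rewrite >⇒≤ᵇ-false p<x | >⇒≤ᵇ-false (ℤP.<-trans p<x (a<a+1 x)) | ≢⇒==-false x≢p = refl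

≤ᵇ-xor-sucʳ : ∀ x p → ((x ≤ᵇ p) xor (x ≤ᵇ p + + 1)) ≡ (x == p + + 1)
≤ᵇ-xor-sucʳ x p with ℤP.<-cmp x (p + + 1)
... | tri< x<p+1 x≢p+1 _
  rewrite ≤⇒≤ᵇ (<+1⇒≤ {b = p} x<p+1) | ≤⇒≤ᵇ (ℤP.<⇒≤ x<p+1) | ≢⇒==-false x≢p+1 = refl
... | tri≈ _ refl _
  rewrite >⇒≤ᵇ-false (a<a+1 p) | ≤⇒≤ᵇ (ℤP.≤-refl {p + + 1}) | ==-refl (p + + 1) = refl
... | tri> _ x≢p+1 p+1<x
  rewrite >⇒≤ᵇ-false (ℤP.<-trans (a<a+1 p) p+1<x) | >⇒≤ᵇ-false p+1<x | ≢⇒==-false x≢p+1 = refl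

infix 4 _≐_
_≐_ : Point → Point → Bool
(a , b) ≐ (c , d) = (a == c) ∧ (b == d)

≐⇒≡ : ∀ u v → (u ≐ v) ≡ true → u ≡ v
≐⇒≡ (a , b) (c , d) eq with a ℤ.≟ c | b ℤ.≟ d
... | yes refl | yes refl = refl
... | no  _    | _        = contradiction eq λ ()
... | yes _    | no  _    = contradiction eq λ ()

data Dir : Set where
  north south east west : Dir

move : Dir → Point → Point
move north (x , y) = (x , y + + 1)
move south (x , y) = (x , y - + 1)
move east  (x , y) = (x + + 1 , y)
move west  (x , y) = (x - + 1 , y)

opposite : Dir → Dir
opposite north = south
opposite south = north
opposite east  = west
opposite west  = east

move-opposite : ∀ d p → move (opposite d) (move d p) ≡ p
move-opposite north (x , y) = cong (x ,_) (a+1-1≡a y)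
move-opposite south (x , y) = cong (x ,_) (a-1+1≡a y)
move-opposite east  (x , y) = cong (_, y) (a+1-1≡a x)
move-opposite west  (x , y) = cong (_, y) (a-1+1≡a x)

opposite-involutive : ∀ d → opposite (opposite d) ≡ d
opposite-involutive north = refl
opposite-involutive south = refl
opposite-involutive east  = refl
opposite-involutive west  = refl

move-opposite⁻ : ∀ d p → move d (move (opposite d) p) ≡ p
move-opposite⁻ d p =
  subst (λ d′ → move d′ (move (opposite d) p) ≡ p) (opposite-involutive d) (move-opposite (opposite d) p)

data Step : Point → Point → Set where
  step-north : ∀ x y → Step (x , y) (x , y + + 1)
  step-east  : ∀ x y → Step (x , y) (x + + 1 , y)

data UnitSq : ℤ → ℤ → Set where
  +1,0 : UnitSq (+ 1) (+ 0)
  -1,0 : UnitSq -[1+ 0 ] (+ 0)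
  0,+1 : UnitSq (+ 0) (+ 1)
  0,-1 : UnitSq (+ 0) -[1+ 0 ]

unitSq : ∀ i j → i * i + j * j ≡ + 1 → UnitSq i j
unitSq (+ 0)           (+ 1)           _ = 0,+1
unitSq (+ 0)           -[1+ 0 ]        _ = 0,-1
unitSq (+ 1)           (+ 0)           _ = +1,0
unitSq -[1+ 0 ]        (+ 0)           _ = -1,0
unitSq (+ 0)           (+ 0)           ()
unitSq (+ 0)           (+ suc (suc _)) ()
unitSq (+ 0)           -[1+ suc _ ]    ()
unitSq (+ 1)           (+ suc _)       ()
unitSq (+ 1)           -[1+ _ ]        ()
unitSq (+ suc (suc _)) (+ 0)           ()
unitSq (+ suc (suc _)) (+ suc _)       ()
unitSq (+ suc (suc _)) -[1+ _ ]        ()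
unitSq -[1+ 0 ]        (+ suc _)       ()
unitSq -[1+ 0 ]        -[1+ _ ]        ()
unitSq -[1+ suc _ ]    (+ 0)           ()
unitSq -[1+ suc _ ]    (+ suc _)       ()
unitSq -[1+ suc _ ]    -[1+ _ ]        ()

a≡c+[a-c] : ∀ a c → a ≡ c + (a - c)
a≡c+[a-c] = solve-∀

a-c≡k⇒a≡c+k : ∀ {a c k} → a - c ≡ k → a ≡ c + k
a-c≡k⇒a≡c+k {a} {c} eq = trans (a≡c+[a-c] a c) (cong (λ k → c + k) eq)

a≡c-1⇒c≡a+1 : ∀ a c → a ≡ c - + 1 → c ≡ a + + 1
a≡c-1⇒c≡a+1 a c eq = trans (sym (a-1+1≡a c)) (cong (_+ + 1) (sym eq))

step-east-from : ∀ {a b c d} → a ≡ c + + 1 → b ≡ d → Step (c , d) (a , b)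
step-east-from refl refl = step-east _ _

step-north-from : ∀ {a b c d} → a ≡ c → b ≡ d + + 1 → Step (c , d) (a , b)
step-north-from refl refl = step-north _ _

∼⇒Step : ∀ u v → u ∼ v → Step u v ⊎ Step v u
∼⇒Step (a , b) (c , d) u∼v with a - c in a-c | b - d in b-d
... | i | j with unitSq i j u∼v
... | +1,0 = inj₂ (step-east-from (a-c≡k⇒a≡c+k a-c) (trans (a-c≡k⇒a≡c+k b-d) (ℤP.+-identityʳ d)))
... | -1,0 = inj₁ (step-east-from (a≡c-1⇒c≡a+1 a c (a-c≡k⇒a≡c+k a-c))
                                  (sym (trans (a-c≡k⇒a≡c+k b-d) (ℤP.+-identityʳ d))))
... | 0,+1 = inj₂ (step-north-from (trans (a-c≡k⇒a≡c+k a-c) (ℤP.+-identityʳ c)) (a-c≡k⇒a≡c+k b-d))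
... | 0,-1 = inj₁ (step-north-from (sym (trans (a-c≡k⇒a≡c+k a-c) (ℤP.+-identityʳ c)))
                                   (a≡c-1⇒c≡a+1 b d (a-c≡k⇒a≡c+k b-d)))

∼-sym : ∀ u v → u ∼ v → v ∼ u
∼-sym (a , b) (c , d) u∼v = trans (sym (square-sym a b c d)) u∼v
  where
  square-sym : ∀ a b c d → (a - c) * (a - c) + (b - d) * (b - d) ≡ (c - a) * (c - a) + (d - b) * (d - b)
  square-sym = solve-∀

move-∼ : ∀ d p → move d p ∼ p
move-∼ north (x , y) = north-unit x y
  where
  north-unit : ∀ x y → (x - x) * (x - x) + ((y + + 1) - y) * ((y + + 1) - y) ≡ + 1
  north-unit = solve-∀
move-∼ south (x , y) = south-unit x y
  where
  south-unit : ∀ x y → (x - x) * (x - x) + ((y - + 1) - y) * ((y - + 1) - y) ≡ + 1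
  south-unit = solve-∀
move-∼ east (x , y) = east-unit x y
  where
  east-unit : ∀ x y → ((x + + 1) - x) * ((x + + 1) - x) + (y - y) * (y - y) ≡ + 1
  east-unit = solve-∀
move-∼ west (x , y) = west-unit x y
  where
  west-unit : ∀ x y → ((x - + 1) - x) * ((x - + 1) - x) + (y - y) * (y - y) ≡ + 1
  west-unit = solve-∀


edgeTo : Point → Dir → Edge
edgeTo (a , b) north = (a , b) , false
edgeTo (a , b) east  = (a , b) , true
edgeTo (a , b) south = (a , b - + 1) , false
edgeTo (a , b) west  = (a - + 1 , b) , true

edgeTo∈incident : ∀ p d → edgeTo p d ∈ incident p
edgeTo∈incident (a , b) east  = here refl
edgeTo∈incident (a , b) north = there (here refl)
edgeTo∈incident (a , b) west  = there (there (here refl))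
edgeTo∈incident (a , b) south = there (there (there (here refl)))

inBoundary-edgeTo : ∀ K p d → inBoundary K (edgeTo p d) ≡ K p xor K (move d p)
inBoundary-edgeTo K (a , b) north = refl
inBoundary-edgeTo K (a , b) east  = refl
inBoundary-edgeTo K (a , b) south
  rewrite a-1+1≡a b = xor-comm (K (a , b - + 1)) (K (a , b))
inBoundary-edgeTo K (a , b) west
  rewrite a-1+1≡a a = xor-comm (K (a - + 1 , b)) (K (a , b))

edge-seen-from : ∀ e {u v} → endpoints e ≡ (u , v) ⊎ endpoints e ≡ (v , u) →
  ∃ λ d → e ≡ edgeTo u d × v ≡ move d u
edge-seen-from ((a , b) , true)  (inj₁ refl) = east , refl , refl
edge-seen-from ((a , b) , false) (inj₁ refl) = north , refl , refl
edge-seen-from ((a , b) , true)  (inj₂ refl) =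
  west , cong (λ x → (x , b) , true) (sym (a+1-1≡a a)) , cong (_, b) (sym (a+1-1≡a a))
edge-seen-from ((a , b) , false) (inj₂ refl) =
  south , cong (λ y → (a , y) , false) (sym (a+1-1≡a b)) , cong (a ,_) (sym (a+1-1≡a b))

a+1==b∧a==b+1 : ∀ a b → ((a + + 1) == b) ∧ (a == b + + 1) ≡ false
a+1==b∧a==b+1 a b with a ℤ.≟ b + + 1
... | no _     = ∧-zeroʳ _
... | yes refl = cong (_∧ true) (≢⇒==-false b+2≢b)
  where
  b+2≢b : b + + 1 + + 1 ≢ b
  b+2≢b eq = ℤP.<-irrefl (sym eq) (ℤP.<-trans (a<a+1 b) (a<a+1 (b + + 1)))

crossesRay-north : ∀ z x y → crossesRay z ((x , y) , (x , y + + 1)) ≡ not (x ≤ᵇ proj₁ z) ∧ (y == proj₂ z)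
crossesRay-north (a , b) x y
  rewrite ==-refl x | +1==+1 y b | a+1==b∧a==b+1 y b | ∨-identityʳ ((y == b) ∧ (y == b)) | ∧-idem (y == b) = refl

crossesRay-east : ∀ z x y → crossesRay z ((x , y) , (x + + 1 , y)) ≡ false
crossesRay-east (a , b) x y rewrite ≢⇒==-false (λ eq → ℤP.<-irrefl eq (a<a+1 x)) = refl

crossesRay-swap : ∀ z u v → crossesRay z (u , v) ≡ crossesRay z (v , u)
crossesRay-swap (a , b) (px , py) (qx , qy) with px ℤ.≟ qx
... | yes refl rewrite ==-refl px =
  cong (not (px ≤ᵇ a) ∧_) (∨-comm ((py == b) ∧ (qy == b + + 1)) ((qy == b) ∧ (py == b + + 1)))
... | no px≢qx rewrite ≢⇒==-false (px≢qx ∘ sym) = refl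

∈-incident⁻ : ∀ p {e} → e ∈ incident p → ∃ λ d → e ≡ edgeTo p d
∈-incident⁻ (a , b) (here refl)                         = east  , refl
∈-incident⁻ (a , b) (there (here refl))                 = north , refl
∈-incident⁻ (a , b) (there (there (here refl)))         = west  , refl
∈-incident⁻ (a , b) (there (there (there (here refl)))) = south , refl

endpoints-edgeTo : ∀ p d → endpoints (edgeTo p d) ≡ (p , move d p) ⊎ endpoints (edgeTo p d) ≡ (move d p , p)
endpoints-edgeTo (a , b) north = inj₁ refl
endpoints-edgeTo (a , b) east  = inj₁ refl
endpoints-edgeTo (a , b) south = inj₂ (cong (λ y → (a , b - + 1) , (a , y)) (a-1+1≡a b))
endpoints-edgeTo (a , b) west  = inj₂ (cong (λ x → (a - + 1 , b) , (x , b)) (a-1+1≡a a))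

-- Crossing parity of closed lattice curves

data Axis : Set where
  horizontal vertical : Axis

along normal : Axis → Dir
along horizontal = east
along vertical   = north
normal horizontal = north
normal vertical   = east

rightOf : Point → Point → Bool
rightOf (a , b) (x , y) = not (x ≤ᵇ a) ∧ (y == b)

-- Contribution of the step e to the change of crossing parity from z to move (normal o) z.
-- Moving the ray up changes crossings along the whole row; the term flips (rightOf …)
-- compensates for that and sums to zero along a closed curve.
crossDiff : Axis → Point → Point × Point → Bool
crossDiff horizontal z e =
  (crossesRay z e xor crossesRay (move north z) e) xor flips (rightOf (move north z)) e
crossDiff vertical z e = crossesRay z e xor crossesRay (move east z) e

rightOf-east-point : ∀ a b x y →
  (rightOf (a , b) (x , y) xor rightOf (a , b) (x + + 1 , y)) ≡ (x == a) ∧ (y == b)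
rightOf-east-point a b x y = begin
  (not (x ≤ᵇ a) ∧ (y == b)) xor (not (x + + 1 ≤ᵇ a) ∧ (y == b))
    ≡⟨ sym (∧-distribʳ-xor (y == b) (not (x ≤ᵇ a)) (not (x + + 1 ≤ᵇ a))) ⟩
  (not (x ≤ᵇ a) xor not (x + + 1 ≤ᵇ a)) ∧ (y == b)
    ≡⟨ cong (_∧ (y == b)) (trans (xor-annihilates-not (x ≤ᵇ a) _) (≤ᵇ-xor-sucˡ x a)) ⟩
  (x == a) ∧ (y == b) ∎
  where open ≡-Reasoning

rightOf-east-origin : ∀ a b x y →
  (rightOf (a , b) (x , y) xor rightOf (a + + 1 , b) (x , y)) ≡ (x == a + + 1) ∧ (y == b)
rightOf-east-origin a b x y = begin
  (not (x ≤ᵇ a) ∧ (y == b)) xor (not (x ≤ᵇ a + + 1) ∧ (y == b))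
    ≡⟨ sym (∧-distribʳ-xor (y == b) (not (x ≤ᵇ a)) (not (x ≤ᵇ a + + 1))) ⟩
  (not (x ≤ᵇ a) xor not (x ≤ᵇ a + + 1)) ∧ (y == b)
    ≡⟨ cong (_∧ (y == b)) (trans (xor-annihilates-not (x ≤ᵇ a) _) (≤ᵇ-xor-sucʳ x a)) ⟩
  (x == a + + 1) ∧ (y == b) ∎
  where open ≡-Reasoning

crossDiff-along : ∀ o z u → crossDiff o z (u , move (along o) u) ≡ (u ≐ move (normal o) z)
crossDiff-along horizontal (a , b) (x , y)
  rewrite crossesRay-east (a , b) x y | crossesRay-east (a , b + + 1) x y = rightOf-east-point a (b + + 1) x y
crossDiff-along vertical (a , b) (x , y)
  rewrite crossesRay-north (a , b) x y | crossesRay-north (a + + 1 , b) x y = rightOf-east-origin a b x y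

crossDiff-normal : ∀ o z u → crossDiff o z (u , move (normal o) u) ≡ false
crossDiff-normal horizontal (a , b) (x , y)
  rewrite crossesRay-north (a , b) x y | crossesRay-north (a , b + + 1) x y | +1==+1 y b
  = trans (cong (_xor (rightOf (a , b + + 1) (x , y) xor rightOf (a , b) (x , y)))
                  (xor-comm (rightOf (a , b) (x , y)) (rightOf (a , b + + 1) (x , y))))
          (xor-same (rightOf (a , b + + 1) (x , y) xor rightOf (a , b) (x , y)))
crossDiff-normal vertical (a , b) (x , y)
  rewrite crossesRay-east (a , b) x y | crossesRay-east (a + + 1 , b) x y = refl

crossDiff-swap : ∀ o z u v → crossDiff o z (u , v) ≡ crossDiff o z (v , u)
crossDiff-swap horizontal z u v
  rewrite crossesRay-swap z u v | crossesRay-swap (move north z) u v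
        | xor-comm (rightOf (move north z) u) (rightOf (move north z) v) = refl
crossDiff-swap vertical z u v
  rewrite crossesRay-swap z u v | crossesRay-swap (move east z) u v = refl

crossDiff-step : ∀ o z {u v} → Step u v → crossDiff o z (u , v) ≡ true → u ≡ move (normal o) z
crossDiff-step horizontal z (step-north x y) eq with () ← trans (sym (crossDiff-normal horizontal z (x , y))) eq
crossDiff-step horizontal z (step-east x y) eq = ≐⇒≡ _ _ (trans (sym (crossDiff-along horizontal z (x , y))) eq)
crossDiff-step vertical z (step-north x y) eq = ≐⇒≡ _ _ (trans (sym (crossDiff-along vertical z (x , y))) eq)
crossDiff-step vertical z (step-east x y) eq with () ← trans (sym (crossDiff-normal vertical z (x , y))) eq

crossDiff-touches : ∀ o z {u v} → u ∼ v → crossDiff o z (u , v) ≡ true →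
  u ≡ move (normal o) z ⊎ v ≡ move (normal o) z
crossDiff-touches o z {u} {v} u∼v eq with ∼⇒Step u v u∼v
... | inj₁ u→v = inj₁ (crossDiff-step o z u→v eq)
... | inj₂ v→u = inj₂ (crossDiff-step o z v→u (trans (crossDiff-swap o z v u) eq))


_≟ₚ_ : DecidableEquality Point
_≟ₚ_ = ≡-dec ℤ._≟_ ℤ._≟_

open import Data.List.Membership.DecPropositional _≟ₚ_ using (_∈?_)

Region : List Point → Point → Set
Region W z = z ∈ W ⊎ crossingParity z W ≡ true

IsLatticeCycle : List Point → Set
IsLatticeCycle W = ∀ {e} → e ∈ cyclicPairs W → proj₁ e ∼ proj₂ e

cyclicPairs-consecutive : ∀ w ws → cyclicPairs (w ∷ ws) ≡ consecutive (w ∷ ws ++ w ∷ [])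
cyclicPairs-consecutive w ws = zip-consecutive w ws w

cyclicPairs-split : ∀ a xs b S →
  cyclicPairs (a ∷ xs ++ b ∷ S) ≡ consecutive (a ∷ xs ++ b ∷ []) ++ consecutive (b ∷ S ++ a ∷ [])
cyclicPairs-split a xs b S = begin
  cyclicPairs (a ∷ xs ++ b ∷ S)                   ≡⟨ cyclicPairs-consecutive a (xs ++ b ∷ S) ⟩
  consecutive (a ∷ (xs ++ b ∷ S) ++ a ∷ [])
    ≡⟨ cong (λ ys → consecutive (a ∷ ys)) (++-assoc xs (b ∷ S) (a ∷ [])) ⟩
  consecutive (a ∷ xs ++ b ∷ S ++ a ∷ [])         ≡⟨ consecutive-++ a xs b (S ++ a ∷ []) ⟩
  consecutive (a ∷ xs ++ b ∷ []) ++ consecutive (b ∷ S ++ a ∷ []) ∎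
  where open ≡-Reasoning

∈-cyclicPairs⁻ : ∀ W {e} → e ∈ cyclicPairs W → proj₁ e ∈ W × proj₂ e ∈ W
∈-cyclicPairs⁻ (w ∷ ws) e∈ rewrite cyclicPairs-consecutive w ws
  with p∈ , q∈ ← ∈-consecutive⁻ (w ∷ ws ++ w ∷ []) e∈ = drop-last p∈ , drop-last q∈
  where
  drop-last : ∀ {z} → z ∈ w ∷ ws ++ w ∷ [] → z ∈ w ∷ ws
  drop-last (here z≡w) = here z≡w
  drop-last (there z∈) with ∈-++⁻ ws z∈
  ... | inj₁ z∈ws        = there z∈ws
  ... | inj₂ (here z≡w)  = here z≡w

parity-flips-cyclic : ∀ G W → parity (flips G) (cyclicPairs W) ≡ false
parity-flips-cyclic G []       = refl
parity-flips-cyclic G (w ∷ ws) rewrite cyclicPairs-consecutive w ws =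
  trans (parity-flips-consecutive G w ws w) (xor-same (G w))

crossingParity-shift : ∀ o z W →
  (crossingParity z W xor crossingParity (move (normal o) z) W) ≡ parity (crossDiff o z) (cyclicPairs W)
crossingParity-shift vertical z W = sym (parity-xor (crossesRay z) (crossesRay (move east z)) (cyclicPairs W))
crossingParity-shift horizontal z W = sym (begin
  parity (crossDiff horizontal z) C
    ≡⟨ parity-xor (λ e → crossesRay z e xor crossesRay z⁺ e) (flips (rightOf z⁺)) C ⟩
  parity (λ e → crossesRay z e xor crossesRay z⁺ e) C xor parity (flips (rightOf z⁺)) C
    ≡⟨ cong₂ _xor_ (parity-xor (crossesRay z) (crossesRay z⁺) C) (parity-flips-cyclic (rightOf z⁺) W) ⟩
  (crossingParity z W xor crossingParity z⁺ W) xor false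
    ≡⟨ xor-identityʳ _ ⟩
  crossingParity z W xor crossingParity z⁺ W ∎)
  where
  open ≡-Reasoning
  C  = cyclicPairs W
  z⁺ = move north z

parity-crossDiff-off : ∀ o z {P : List Point} (C : List (Point × Point)) →
  (∀ {e} → e ∈ C → proj₁ e ∼ proj₂ e) → (∀ {e} → e ∈ C → proj₁ e ∈ P × proj₂ e ∈ P) →
  move (normal o) z ∉ P → parity (crossDiff o z) C ≡ false
parity-crossDiff-off o z C adjacent ends⊆P z⁺∉P = parity-allFalse C vanishes
  where
  vanishes : ∀ {e} → e ∈ C → crossDiff o z e ≡ false
  vanishes {u , v} e∈ with crossDiff o z (u , v) in eq
  ... | false = refl
  ... | true with crossDiff-touches o z (adjacent e∈) eq
  ...   | inj₁ refl = contradiction (proj₁ (ends⊆P e∈)) z⁺∉P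
  ...   | inj₂ refl = contradiction (proj₂ (ends⊆P e∈)) z⁺∉P

xor-false⇒≡ : ∀ {a b} → (a xor b) ≡ false → a ≡ b
xor-false⇒≡ {false} {false} _ = refl
xor-false⇒≡ {true}  {true}  _ = refl

rightOf⇒< : ∀ a b x y → rightOf (a , b) (x , y) ≡ true → a < x × y ≡ b
rightOf⇒< a b x y eq with x ≤ᵇ a in x≤a
... | false = ≤ᵇ-false⇒> x≤a , ==⇒≡ eq

crossesRay-step⇒rightOf : ∀ z {u v} → Step u v → crossesRay z (u , v) ≡ true → rightOf z u ≡ true
crossesRay-step⇒rightOf z (step-north x y) eq = trans (sym (crossesRay-north z x y)) eq
crossesRay-step⇒rightOf z (step-east x y)  eq with () ← trans (sym (crossesRay-east z x y)) eq

crossesRay⇒rightOf : ∀ z {u v} → u ∼ v → crossesRay z (u , v) ≡ true →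
  rightOf z u ≡ true ⊎ rightOf z v ≡ true
crossesRay⇒rightOf z {u} {v} u∼v eq with ∼⇒Step u v u∼v
... | inj₁ u→v = inj₁ (crossesRay-step⇒rightOf z u→v eq)
... | inj₂ v→u = inj₂ (crossesRay-step⇒rightOf z v→u (trans (crossesRay-swap z v u) eq))

crossesRay-step-left : ∀ a b {u v} → Step u v → a < proj₁ u →
  crossesRay (a , b) (u , v) ≡ flips (λ w → proj₂ w ≤ᵇ b) (u , v)
crossesRay-step-left a b (step-north x y) a<x
  rewrite crossesRay-north (a , b) x y | >⇒≤ᵇ-false a<x = sym (≤ᵇ-xor-sucˡ y b)
crossesRay-step-left a b (step-east x y) _
  rewrite crossesRay-east (a , b) x y = sym (xor-same (y ≤ᵇ b))

crossesRay-left : ∀ a b {u v} → u ∼ v → a < proj₁ u → a < proj₁ v →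
  crossesRay (a , b) (u , v) ≡ flips (λ w → proj₂ w ≤ᵇ b) (u , v)
crossesRay-left a b {u} {v} u∼v a<u a<v with ∼⇒Step u v u∼v
... | inj₁ u→v = crossesRay-step-left a b u→v a<u
... | inj₂ v→u = begin
  crossesRay (a , b) (u , v)           ≡⟨ crossesRay-swap (a , b) u v ⟩
  crossesRay (a , b) (v , u)           ≡⟨ crossesRay-step-left a b v→u a<v ⟩
  flips (λ w → proj₂ w ≤ᵇ b) (v , u)   ≡⟨ xor-comm (proj₂ v ≤ᵇ b) (proj₂ u ≤ᵇ b) ⟩
  flips (λ w → proj₂ w ≤ᵇ b) (u , v)   ∎
  where open ≡-Reasoning

InInterval : ℕ → ℤ → Set
InInterval N t = ℤ.- (+ N) ≤ t × t ≤ + N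

interval : ℕ → List ℤ
interval N = map +_ (upTo (suc N)) ++ map -[1+_] (upTo N)

∈-interval : ∀ {N t} → InInterval N t → t ∈ interval N
∈-interval {N}     {+ n}      (_ , +≤+ n≤N) = ∈-++⁺ˡ (∈-map⁺ +_ (∈-upTo⁺ (s≤s n≤N)))
∈-interval {suc N} { -[1+ n ]} (-≤- n≤N , _) =
  ∈-++⁺ʳ (map +_ (upTo (suc (suc N)))) (∈-map⁺ -[1+_] (∈-upTo⁺ (s≤s n≤N)))

square : ℕ → List Point
square N = cartesianProduct (interval N) (interval N)

∣∣≤⇒InInterval : ∀ {t N} → ∣ t ∣ ℕ.≤ N → InInterval N t
∣∣≤⇒InInterval {+ n}      n≤N       = ℤP.neg-≤-pos , +≤+ n≤N
∣∣≤⇒InInterval { -[1+ n ]} (s≤s n≤N) = -≤- n≤N , -≤+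

radius : List Point → ℕ
radius []            = 0
radius ((x , y) ∷ W) = ∣ x ∣ ℕ.+ ∣ y ∣ ℕ.+ radius W

∈⇒InInterval-radius : ∀ W {x y} → (x , y) ∈ W → InInterval (radius W) x × InInterval (radius W) y
∈⇒InInterval-radius ((x , y) ∷ W) (here refl) =
  ∣∣≤⇒InInterval (ℕP.≤-trans (ℕP.m≤m+n ∣ x ∣ ∣ y ∣) (ℕP.m≤m+n _ (radius W))) ,
  ∣∣≤⇒InInterval (ℕP.≤-trans (ℕP.m≤n+m ∣ y ∣ ∣ x ∣) (ℕP.m≤m+n _ (radius W)))
∈⇒InInterval-radius ((x′ , y′) ∷ W) (there p∈) with ∈⇒InInterval-radius W p∈
... | (x-lo , x-hi) , (y-lo , y-hi) =
  (ℤP.≤-trans (ℤP.neg-mono-≤ (+≤+ grow)) x-lo , ℤP.≤-trans x-hi (+≤+ grow)) ,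
  (ℤP.≤-trans (ℤP.neg-mono-≤ (+≤+ grow)) y-lo , ℤP.≤-trans y-hi (+≤+ grow))
  where
  grow : radius W ℕ.≤ ∣ x′ ∣ ℕ.+ ∣ y′ ∣ ℕ.+ radius W
  grow = ℕP.m≤n+m (radius W) _

module _ {W : List Point} (cycle : IsLatticeCycle W) where

  crossingParity-normal-step : ∀ o z → move (normal o) z ∉ W →
    crossingParity z W ≡ crossingParity (move (normal o) z) W
  crossingParity-normal-step o z z⁺∉W = xor-false⇒≡
    (trans (crossingParity-shift o z W) (parity-crossDiff-off o z (cyclicPairs W) cycle (∈-cyclicPairs⁻ W) z⁺∉W))

  crossingParity-normal-back : ∀ o z → z ∉ W →
    crossingParity z W ≡ crossingParity (move (opposite (normal o)) z) W
  crossingParity-normal-back o z z∉W = sym (trans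
    (crossingParity-normal-step o (move (opposite (normal o)) z) (subst (_∉ W) (sym back-forth) z∉W))
    (cong (λ p → crossingParity p W) back-forth))
    where
    back-forth : move (normal o) (move (opposite (normal o)) z) ≡ z
    back-forth = move-opposite⁻ (normal o) z

  -- Off the curve, a step never changes the crossing parity.
  region-move : ∀ {z} → z ∉ W → Region W z → ∀ d → Region W (move d z)
  region-move z∉W (inj₁ z∈W) d = contradiction z∈W z∉W
  region-move {z} z∉W (inj₂ odd) d with move d z ∈? W
  ... | yes dz∈W = inj₁ dz∈W
  ... | no  dz∉W = inj₂ (trans (sym (parity-preserved d dz∉W)) odd)
    where
    parity-preserved : ∀ d → move d z ∉ W → crossingParity z W ≡ crossingParity (move d z) W
    parity-preserved north dz∉W = crossingParity-normal-step horizontal z dz∉W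
    parity-preserved east  dz∉W = crossingParity-normal-step vertical z dz∉W
    parity-preserved south _    = crossingParity-normal-back horizontal z z∉W
    parity-preserved west  _    = crossingParity-normal-back vertical z z∉W

  odd⇒rightOf : ∀ z → crossingParity z W ≡ true → ∃ λ w → w ∈ W × rightOf z w ≡ true
  odd⇒rightOf z odd with find (parity-true⇒Any (crossesRay z) (cyclicPairs W) odd)
  ... | (u , v) , e∈ , crosses with crossesRay⇒rightOf z {u} {v} (cycle {u , v} e∈) crosses
  ...   | inj₁ on-right = u , proj₁ (∈-cyclicPairs⁻ W e∈) , on-right
  ...   | inj₂ on-right = v , proj₂ (∈-cyclicPairs⁻ W e∈) , on-right

  crossingParity-left : ∀ a b → (∀ {w} → w ∈ W → a < proj₁ w) → crossingParity (a , b) W ≡ false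
  crossingParity-left a b a<W = trans
    (parity-cong (cyclicPairs W) (λ {e} e∈ →
      crossesRay-left a b {proj₁ e} {proj₂ e} (cycle {e} e∈)
        (a<W (proj₁ (∈-cyclicPairs⁻ W e∈))) (a<W (proj₂ (∈-cyclicPairs⁻ W e∈)))))
    (parity-flips-cyclic (λ w → proj₂ w ≤ᵇ b) W)

  region-bounded : ∀ {a b} → Region W (a , b) → InInterval (radius W) a × InInterval (radius W) b
  region-bounded (inj₁ z∈W) = ∈⇒InInterval-radius W z∈W
  region-bounded {a} {b} (inj₂ odd) with odd⇒rightOf (a , b) odd
  ... | (x , y) , w∈W , on-right with rightOf⇒< a b x y on-right | ∈⇒InInterval-radius W w∈W
  ...   | a<x , refl | (_ , x-hi) , y-bounds = (a-lo , ℤP.<⇒≤ (ℤP.<-≤-trans a<x x-hi)) , y-bounds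
    where
    a-lo : ℤ.- (+ radius W) ≤ a
    a-lo = ℤP.≮⇒≥ λ a<-R → contradiction
      (trans (sym (crossingParity-left a b λ w∈ →
        ℤP.<-≤-trans a<-R (proj₁ (proj₁ (∈⇒InInterval-radius W w∈))))) odd)
      λ ()

  region⊆square : ∀ {z} → Region W z → z ∈ square (radius W)
  region⊆square {a , b} z∈R with region-bounded z∈R
  ... | a-bounds , b-bounds = ∈-cartesianProduct⁺ (∈-interval a-bounds) (∈-interval b-bounds)

-- Walks along a line

-- Chain next a xs b : the list a ∷ xs ++ b ∷ [] is an orbit segment of next.
data Chain (next : ℤ → ℤ) : ℤ → List ℤ → ℤ → Set where
  done : ∀ {a} → Chain next a [] (next a)
  step : ∀ {a xs b} → Chain next (next a) xs b → Chain next a (next a ∷ xs) b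

module _ {next : ℤ → ℤ} where

  chain-applyUpTo : ∀ n (g : ℕ → ℤ) {a} → g 0 ≡ next a → (∀ k → g (suc k) ≡ next (g k)) →
    Chain next a (applyUpTo g n) (g n)
  chain-applyUpTo zero    g g0≡ g-next = subst (Chain next _ []) (sym g0≡) done
  chain-applyUpTo (suc n) g g0≡ g-next =
    subst (λ h → Chain next _ (h ∷ applyUpTo (g ∘ suc) n) (g (suc n))) (sym g0≡)
      (step (subst (λ h → Chain next h (applyUpTo (g ∘ suc) n) (g (suc n))) g0≡
        (chain-applyUpTo n (g ∘ suc) (g-next 0) (g-next ∘ suc))))

  chain-consecutive : ∀ {a xs b} → Chain next a xs b →
    ∀ {p q} → (p , q) ∈ consecutive (a ∷ xs ++ b ∷ []) → q ≡ next p
  chain-consecutive done       (here refl) = refl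
  chain-consecutive (step ch)  (here refl) = refl
  chain-consecutive (step ch)  (there pq∈) = chain-consecutive ch pq∈

  chain-head : ∀ {a xs b} → Chain next a xs b → next a ∈ xs ++ b ∷ []
  chain-head done     = here refl
  chain-head (step _) = here refl

  chain-successor : ∀ {a xs b t} → Chain next a xs b → t ∈ xs → next t ∈ xs ++ b ∷ []
  chain-successor (step ch) (here refl) = there (chain-head ch)
  chain-successor (step ch) (there t∈)  = there (chain-successor ch t∈)

  chain-predecessor : ∀ {a xs b t} → Chain next a xs b → t ∈ xs → ∃ λ p → p ∈ a ∷ xs × t ≡ next p
  chain-predecessor (step ch) (here refl) = _ , here refl , refl
  chain-predecessor (step ch) (there t∈) with p , p∈ , t≡ ← chain-predecessor ch t∈ = p , there p∈ , t≡

  module _ (_R_ : ℤ → ℤ → Set) (R-trans : ∀ {p q r} → p R q → q R r → p R r)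
           (R-next : ∀ p → p R next p) where

    chain-end : ∀ {a xs b} → Chain next a xs b → a R b
    chain-end done      = R-next _
    chain-end (step ch) = R-trans (R-next _) (chain-end ch)

    chain-between : ∀ {a xs b t} → Chain next a xs b → t ∈ xs → a R t × t R b
    chain-between (step ch) (here refl) = R-next _ , chain-end ch
    chain-between (step ch) (there t∈) with chain-between ch t∈
    ... | aRt , tRb = R-trans (R-next _) aRt , tRb

gap-ascending : ∀ {a b} → a < b → ∃ λ n → b - a ≡ + suc n
gap-ascending {a} {b} a<b with b - a in b-a
... | + suc n  = n , refl
... | + zero   = contradiction (trans (a-c≡k⇒a≡c+k b-a) (ℤP.+-identityʳ a)) (λ b≡a → ℤP.<-irrefl (sym b≡a) a<b)
... | -[1+ n ] = contradiction (subst (_≤ a) (sym (a-c≡k⇒a≡c+k b-a)) (ℤP.i-j≤i a (+ suc n))) (ℤP.<⇒≱ a<b)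

gap-descending : ∀ {a b} → b < a → ∃ λ n → b - a ≡ -[1+ n ]
gap-descending {a} {b} b<a with b - a in b-a
... | -[1+ n ] = n , refl
... | + zero   = contradiction (trans (a-c≡k⇒a≡c+k b-a) (ℤP.+-identityʳ a)) (λ b≡a → ℤP.<-irrefl b≡a b<a)
... | + suc n  = contradiction (subst (a ≤_) (sym (a-c≡k⇒a≡c+k b-a)) (ℤP.i≤i+j a (+ suc n))) (ℤP.<⇒≱ b<a)

a+[2+k]≡a+[1+k]+1 : ∀ a k → a + + suc (suc k) ≡ (a + + suc k) + + 1
a+[2+k]≡a+[1+k]+1 a k =
  trans (cong (λ n → a + + n) (ℕP.+-comm 1 (suc k))) (sym (ℤP.+-assoc a (+ suc k) (+ 1)))

a-[2+k]≡a-[1+k]-1 : ∀ a k → a - + suc (suc k) ≡ (a - + suc k) - + 1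
a-[2+k]≡a-[1+k]-1 a k =
  trans (cong (λ n → a + -[1+ n ]) (sym (ℕP.+-identityʳ (suc k)))) (sym (ℤP.+-assoc a -[1+ k ] -[1+ 0 ]))

walk : ℤ → ℤ → List ℤ
walk a b = a ∷ strictlyBetween a b ++ b ∷ []

walk-chain : ∀ {a b} → a ≢ b →
  Chain (_+ + 1) a (strictlyBetween a b) b ⊎ Chain (_- + 1) a (strictlyBetween a b) b
walk-chain {a} {b} a≢b with ℤP.<-cmp a b
... | tri≈ _ a≡b _ = contradiction a≡b a≢b
... | tri< a<b _ _ with n , b-a ← gap-ascending a<b
  rewrite ≤⇒≤ᵇ (ℤP.<⇒≤ a<b) | b-a | map-upTo (λ k → a + + suc k) n =
  inj₁ (subst (Chain _ a _) (sym (a-c≡k⇒a≡c+k b-a))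
    (chain-applyUpTo n (λ k → a + + suc k) refl (λ k → a+[2+k]≡a+[1+k]+1 a k)))
... | tri> _ _ b<a with n , b-a ← gap-descending b<a
  rewrite >⇒≤ᵇ-false b<a | b-a | map-upTo (λ k → a - + suc k) n =
  inj₂ (subst (Chain _ a _) (sym (a-c≡k⇒a≡c+k b-a))
    (chain-applyUpTo n (λ k → a - + suc k) refl (λ k → a-[2+k]≡a-[1+k]-1 a k)))

walk-steps : ∀ {a b} → a ≢ b → ∀ {p q} → (p , q) ∈ consecutive (walk a b) → q ≡ p + + 1 ⊎ p ≡ q + + 1
walk-steps a≢b pq∈ with walk-chain a≢b
... | inj₁ ch = inj₁ (chain-consecutive ch pq∈)
... | inj₂ ch = inj₂ (a≡c-1⇒c≡a+1 _ _ (chain-consecutive ch pq∈))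

∈-walk-init : ∀ {a b p} → p ∈ a ∷ strictlyBetween a b → p ∈ walk a b
∈-walk-init (here p≡a) = here p≡a
∈-walk-init (there p∈) = there (∈-++⁺ˡ p∈)

walk-neighbours : ∀ {a b t} → a ≢ b → t ∈ strictlyBetween a b → t + + 1 ∈ walk a b × t - + 1 ∈ walk a b
walk-neighbours {a} {b} {t} a≢b t∈ with walk-chain a≢b
... | inj₁ ch with p , p∈ , refl ← chain-predecessor ch t∈ =
  there (chain-successor ch t∈) , subst (_∈ walk a b) (sym (a+1-1≡a p)) (∈-walk-init p∈)
... | inj₂ ch with p , p∈ , refl ← chain-predecessor ch t∈ =
  subst (_∈ walk a b) (sym (a-1+1≡a p)) (∈-walk-init p∈) , there (chain-successor ch t∈)

walk-separates : ∀ {a b t} → a ≢ b → t ∈ strictlyBetween a b → ((a ≤ᵇ t) xor (b ≤ᵇ t)) ≡ true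
walk-separates a≢b t∈ with walk-chain a≢b
... | inj₁ ch with a<t , t<b ← chain-between _<_ ℤP.<-trans a<a+1 ch t∈
  rewrite ≤⇒≤ᵇ (ℤP.<⇒≤ a<t) | >⇒≤ᵇ-false t<b = refl
... | inj₂ ch with t<a , b<t ← chain-between _>_ (λ p>q q>r → ℤP.<-trans q>r p>q) a-1<a ch t∈
  rewrite >⇒≤ᵇ-false t<a | ≤⇒≤ᵇ (ℤP.<⇒≤ b<t) = refl


-- Lines, and the curve of the theorem

axis : Side → Axis
axis up    = horizontal
axis down  = horizontal
axis right = vertical
axis left  = vertical

onLine : Axis → ℤ → ℤ → Point
onLine horizontal c t = t , c
onLine vertical   c t = c , t

position level : Axis → Point → ℤ
position horizontal (x , y) = x
position vertical   (x , y) = y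
level horizontal (x , y) = y
level vertical   (x , y) = x

segmentBetween-onLine : ∀ s c p q →
  segmentBetween s c p q ≡ map (onLine (axis s) c) (strictlyBetween (position (axis s) p) (position (axis s) q))
segmentBetween-onLine up    c p q = refl
segmentBetween-onLine down  c p q = refl
segmentBetween-onLine right c p q = refl
segmentBetween-onLine left  c p q = refl

offset-zero⇒onLine : ∀ s c p → offset s c p ≡ + 0 → p ≡ onLine (axis s) c (position (axis s) p)
offset-zero⇒onLine up    c (x , y) eq = cong (x ,_) (trans (a-c≡k⇒a≡c+k eq) (ℤP.+-identityʳ c))
offset-zero⇒onLine down  c (x , y) eq = cong (x ,_) (sym (trans (a-c≡k⇒a≡c+k eq) (ℤP.+-identityʳ y)))
offset-zero⇒onLine right c (x , y) eq = cong (_, y) (trans (a-c≡k⇒a≡c+k eq) (ℤP.+-identityʳ c))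
offset-zero⇒onLine left  c (x , y) eq = cong (_, y) (sym (trans (a-c≡k⇒a≡c+k eq) (ℤP.+-identityʳ x)))

move-along-onLine : ∀ o c t → move (along o) (onLine o c t) ≡ onLine o c (t + + 1)
move-along-onLine horizontal c t = refl
move-along-onLine vertical   c t = refl

move-back-onLine : ∀ o c t → move (opposite (along o)) (onLine o c t) ≡ onLine o c (t - + 1)
move-back-onLine horizontal c t = refl
move-back-onLine vertical   c t = refl

onLine-≐ : ∀ o c s t → (onLine o c s ≐ onLine o c t) ≡ (s == t)
onLine-≐ horizontal c s t rewrite ==-refl c = ∧-identityʳ (s == t)
onLine-≐ vertical   c s t rewrite ==-refl c = refl

level-onLine : ∀ o c t → level o (onLine o c t) ≡ c
level-onLine horizontal c t = refl
level-onLine vertical   c t = refl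

tabulate-∷ʳ : ∀ {A : Set} n (g : Fin (suc n) → A) →
  tabulate g ≡ tabulate (λ i → g (inject₁ i)) ++ g (fromℕ n) ∷ []
tabulate-∷ʳ zero    g = refl
tabulate-∷ʳ (suc n) g = cong (g zero ∷_) (tabulate-∷ʳ n (λ i → g (fsuc i)))

∈-consecutive-tabulate⁻ : ∀ {A : Set} n (g : Fin (suc n) → A) {p q} → (p , q) ∈ consecutive (tabulate g) →
  ∃ λ i → p ≡ g (inject₁ i) × q ≡ g (fsuc i)
∈-consecutive-tabulate⁻ (suc n) g (here refl)  = zero , refl , refl
∈-consecutive-tabulate⁻ (suc n) g (there pq∈)
  with i , refl , refl ← ∈-consecutive-tabulate⁻ n (λ i → g (fsuc i)) pq∈ = fsuc i , refl , refl

linePair : Axis → ℤ → ℤ × ℤ → Point × Point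
linePair o c (p , q) = onLine o c p , onLine o c q

crossDiff-along-line : ∀ o c z p t → move (normal o) z ≡ onLine o c t →
  crossDiff o z (onLine o c p , onLine o c (p + + 1)) ≡ (p == t)
crossDiff-along-line o c z p t z⁺≡ = begin
  crossDiff o z (onLine o c p , onLine o c (p + + 1))
    ≡⟨ cong (λ q → crossDiff o z (onLine o c p , q)) (sym (move-along-onLine o c p)) ⟩
  crossDiff o z (onLine o c p , move (along o) (onLine o c p))
    ≡⟨ crossDiff-along o z (onLine o c p) ⟩
  (onLine o c p ≐ move (normal o) z)
    ≡⟨ cong (onLine o c p ≐_) z⁺≡ ⟩
  (onLine o c p ≐ onLine o c t)
    ≡⟨ onLine-≐ o c p t ⟩
  (p == t) ∎
  where open ≡-Reasoning

parity-crossDiff-walk : ∀ o c z {t a b} → a ≢ b → move (normal o) z ≡ onLine o c t →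
  parity (crossDiff o z) (map (linePair o c) (consecutive (walk a b))) ≡ (a ≤ᵇ t) xor (b ≤ᵇ t)
parity-crossDiff-walk o c z {t} {a} {b} a≢b z⁺≡ = begin
  parity (crossDiff o z) (map (linePair o c) (consecutive (walk a b)))
    ≡⟨ parity-map (crossDiff o z) (linePair o c) (consecutive (walk a b)) ⟩
  parity (λ e → crossDiff o z (linePair o c e)) (consecutive (walk a b))
    ≡⟨ parity-cong (consecutive (walk a b)) step-value ⟩
  parity (flips (_≤ᵇ t)) (consecutive (walk a b))
    ≡⟨ parity-flips-consecutive (_≤ᵇ t) a (strictlyBetween a b) b ⟩
  (a ≤ᵇ t) xor (b ≤ᵇ t) ∎
  where
  open ≡-Reasoning
  step-value : ∀ {e} → e ∈ consecutive (walk a b) → crossDiff o z (linePair o c e) ≡ flips (_≤ᵇ t) e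
  step-value {p , q} pq∈ with walk-steps a≢b pq∈
  ... | inj₁ refl = trans (crossDiff-along-line o c z p t z⁺≡) (sym (≤ᵇ-xor-sucˡ p t))
  ... | inj₂ refl = begin
    crossDiff o z (onLine o c (q + + 1) , onLine o c q)  ≡⟨ crossDiff-swap o z _ _ ⟩
    crossDiff o z (onLine o c q , onLine o c (q + + 1))  ≡⟨ crossDiff-along-line o c z q t z⁺≡ ⟩
    (q == t)                                            ≡⟨ sym (≤ᵇ-xor-sucˡ q t) ⟩
    (q ≤ᵇ t) xor (q + + 1 ≤ᵇ t)                          ≡⟨ xor-comm (q ≤ᵇ t) _ ⟩
    (q + + 1 ≤ᵇ t) xor (q ≤ᵇ t)                          ∎

record LinePoint (W : List Point) (o : Axis) (c : ℤ) (w : Point) : Set where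
  field
    on-line          : level o w ≡ c
    along-neighbours : move (along o) w ∈ W × move (opposite (along o)) w ∈ W
    normal-neighbour : Region W (move (normal o) w) ⊎ Region W (move (opposite (normal o)) w)

module Curve {n : ℕ} (x : Fin (suc (suc n)) → Point)
  (x-adjacent : ∀ i → x (inject₁ i) ∼ x (fsuc i))
  (s : Side) (c : ℤ)
  (x₀-on-ℓ : offset s c (x zero) ≡ + 0) (xₘ-on-ℓ : offset s c (x (fromℕ (suc n))) ≡ + 0)
  (x₀≢xₘ : x zero ≢ x (fromℕ (suc n))) where

  o : Axis
  o = axis s

  path : List Point
  path = tabulate x

  α β : ℤ
  α = position o (x (fromℕ (suc n)))
  β = position o (x zero)

  W : List Point
  W = curve s c (suc n) x

  xₘ≡ : x (fromℕ (suc n)) ≡ onLine o c α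
  xₘ≡ = offset-zero⇒onLine s c _ xₘ-on-ℓ

  x₀≡ : x zero ≡ onLine o c β
  x₀≡ = offset-zero⇒onLine s c _ x₀-on-ℓ

  α≢β : α ≢ β
  α≢β α≡β = x₀≢xₘ (trans x₀≡ (trans (cong (onLine o c) (sym α≡β)) (sym xₘ≡)))

  W≡ : W ≡ path ++ map (onLine o c) (strictlyBetween α β)
  W≡ = cong (path ++_) (segmentBetween-onLine s c (x (fromℕ (suc n))) (x zero))

  cyclicPairs-W : cyclicPairs W ≡ consecutive path ++ map (linePair o c) (consecutive (walk α β))
  cyclicPairs-W = begin
    cyclicPairs (path ++ S)
      ≡⟨ cong (λ P → cyclicPairs (P ++ S)) (tabulate-∷ʳ (suc n) x) ⟩
    cyclicPairs ((x zero ∷ T ++ xₘ ∷ []) ++ S)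
      ≡⟨ cong cyclicPairs (++-assoc (x zero ∷ T) (xₘ ∷ []) S) ⟩
    cyclicPairs (x zero ∷ T ++ xₘ ∷ S)
      ≡⟨ cyclicPairs-split (x zero) T xₘ S ⟩
    consecutive (x zero ∷ T ++ xₘ ∷ []) ++ consecutive (xₘ ∷ S ++ x zero ∷ [])
      ≡⟨ cong₂ (λ P Q → consecutive P ++ consecutive Q) (sym (tabulate-∷ʳ (suc n) x)) closing-walk ⟩
    consecutive path ++ consecutive (map (onLine o c) (walk α β))
      ≡⟨ cong (consecutive path ++_) (consecutive-map (onLine o c) (walk α β)) ⟩
    consecutive path ++ map (linePair o c) (consecutive (walk α β)) ∎
    where
    open ≡-Reasoning
    xₘ = x (fromℕ (suc n))
    S = segmentBetween s c xₘ (x zero)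
    T = tabulate (λ i → x (inject₁ (fsuc i)))
    closing-walk : xₘ ∷ S ++ x zero ∷ [] ≡ map (onLine o c) (walk α β)
    closing-walk = begin
      xₘ ∷ S ++ x zero ∷ []
        ≡⟨ cong₂ (λ p S′ → p ∷ S′ ++ x zero ∷ []) xₘ≡ (segmentBetween-onLine s c xₘ (x zero)) ⟩
      onLine o c α ∷ map (onLine o c) (strictlyBetween α β) ++ x zero ∷ []
        ≡⟨ cong (λ p → onLine o c α ∷ map (onLine o c) (strictlyBetween α β) ++ p ∷ []) x₀≡ ⟩
      onLine o c α ∷ map (onLine o c) (strictlyBetween α β) ++ onLine o c β ∷ []
        ≡⟨ cong (onLine o c α ∷_) (sym (map-++ (onLine o c) (strictlyBetween α β) (β ∷ []))) ⟩
      map (onLine o c) (walk α β) ∎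

  path-adjacent : ∀ {e} → e ∈ consecutive path → proj₁ e ∼ proj₂ e
  path-adjacent {p , q} e∈ with i , refl , refl ← ∈-consecutive-tabulate⁻ (suc n) x e∈ = x-adjacent i

  line-adjacent : ∀ {p q} → q ≡ p + + 1 ⊎ p ≡ q + + 1 → onLine o c p ∼ onLine o c q
  line-adjacent {p} (inj₁ refl) = subst (onLine o c p ∼_) (move-along-onLine o c p)
    (∼-sym (move (along o) (onLine o c p)) (onLine o c p) (move-∼ (along o) (onLine o c p)))
  line-adjacent {q = q} (inj₂ refl) =
    subst (_∼ onLine o c q) (move-along-onLine o c q) (move-∼ (along o) (onLine o c q))

  cycle : IsLatticeCycle W
  cycle {e} e∈ rewrite cyclicPairs-W with ∈-++⁻ (consecutive path) e∈
  ... | inj₁ e∈path = path-adjacent e∈path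
  ... | inj₂ e∈line with (p , q) , pq∈ , refl ← ∈-map⁻ (linePair o c) e∈line =
    line-adjacent (walk-steps α≢β pq∈)

  ∈-W⁻ : ∀ {w} → w ∈ W → w ∈ path ⊎ ∃ λ t → t ∈ strictlyBetween α β × w ≡ onLine o c t
  ∈-W⁻ w∈ rewrite W≡ with ∈-++⁻ path w∈
  ... | inj₁ w∈path = inj₁ w∈path
  ... | inj₂ w∈seg with t , t∈ , w≡ ← ∈-map⁻ (onLine o c) w∈seg = inj₂ (t , t∈ , w≡)

  walk⊆W : ∀ {t} → t ∈ walk α β → onLine o c t ∈ W
  walk⊆W (here refl) = subst (_∈ W) xₘ≡ (∈-++⁺ˡ (∈-tabulate⁺ {f = x} (fromℕ (suc n))))
  walk⊆W {t} (there t∈) with ∈-++⁻ (strictlyBetween α β) t∈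
  ... | inj₁ t∈seg       = subst (onLine o c t ∈_) (sym W≡) (∈-++⁺ʳ path (∈-map⁺ (onLine o c) {x = t} t∈seg))
  ... | inj₂ (here refl) = subst (_∈ W) x₀≡ (∈-++⁺ˡ (∈-tabulate⁺ {f = x} zero))

  segment-neighbours : ∀ {t} → t ∈ strictlyBetween α β →
    move (along o) (onLine o c t) ∈ W × move (opposite (along o)) (onLine o c t) ∈ W
  segment-neighbours {t} t∈ with t+1∈ , t-1∈ ← walk-neighbours α≢β t∈ =
    subst (_∈ W) (sym (move-along-onLine o c t)) (walk⊆W t+1∈) ,
    subst (_∈ W) (sym (move-back-onLine o c t)) (walk⊆W t-1∈)

  segment-parity-jump : ∀ {t} → t ∈ strictlyBetween α β → onLine o c t ∉ path →
    (crossingParity (move (opposite (normal o)) (onLine o c t)) W xor crossingParity (onLine o c t) W) ≡ true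
  segment-parity-jump {t} t∈ w∉path = begin
    crossingParity z W xor crossingParity w W
      ≡⟨ cong (λ p → crossingParity z W xor crossingParity p W) (sym z⁺≡w) ⟩
    crossingParity z W xor crossingParity (move (normal o) z) W
      ≡⟨ crossingParity-shift o z W ⟩
    parity (crossDiff o z) (cyclicPairs W)
      ≡⟨ cong (parity (crossDiff o z)) cyclicPairs-W ⟩
    parity (crossDiff o z) (consecutive path ++ map (linePair o c) (consecutive (walk α β)))
      ≡⟨ parity-++ (crossDiff o z) (consecutive path) _ ⟩
    parity (crossDiff o z) (consecutive path) xor parity (crossDiff o z) (map (linePair o c) (consecutive (walk α β)))
      ≡⟨ cong₂ _xor_ path-part (parity-crossDiff-walk o c z α≢β z⁺≡w) ⟩
    (α ≤ᵇ t) xor (β ≤ᵇ t)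
      ≡⟨ walk-separates α≢β t∈ ⟩
    true ∎
    where
    open ≡-Reasoning
    w = onLine o c t
    z = move (opposite (normal o)) w
    z⁺≡w : move (normal o) z ≡ w
    z⁺≡w = move-opposite⁻ (normal o) w
    path-part : parity (crossDiff o z) (consecutive path) ≡ false
    path-part = parity-crossDiff-off o z (consecutive path) path-adjacent (∈-consecutive⁻ path)
      (subst (_∉ path) (sym z⁺≡w) w∉path)

  segment-separates : ∀ {t} → t ∈ strictlyBetween α β → onLine o c t ∉ path →
    Region W (move (normal o) (onLine o c t)) ⊎ Region W (move (opposite (normal o)) (onLine o c t))
  segment-separates {t} t∈ w∉path with xor≡true-cases (segment-parity-jump t∈ w∉path)
  ... | inj₁ (below-odd , _) = inj₂ (inj₂ below-odd)
  ... | inj₂ (_ , w-odd) with move (normal o) (onLine o c t) ∈? W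
  ...   | yes above∈W = inj₁ (inj₁ above∈W)
  ...   | no  above∉W = inj₁ (inj₂ (trans (sym (crossingParity-normal-step cycle o (onLine o c t) above∉W)) w-odd))

  curve-LinePoint : ∀ {w} → w ∈ W → w ∉ path → LinePoint W o c w
  curve-LinePoint w∈W w∉path with ∈-W⁻ w∈W
  ... | inj₁ w∈path          = contradiction w∈path w∉path
  ... | inj₂ (t , t∈ , refl) = record
    { on-line          = level-onLine o c t
    ; along-neighbours = segment-neighbours t∈
    ; normal-neighbour = segment-separates t∈ w∉path
    }

-- The comparison argument

data Perpendicular : Axis → Dir → Set where
  forward  : ∀ {o} → Perpendicular o (normal o)
  backward : ∀ {o} → Perpendicular o (opposite (normal o))

dir-cases : ∀ o d → d ≡ along o ⊎ d ≡ opposite (along o) ⊎ Perpendicular o d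
dir-cases horizontal north = inj₂ (inj₂ forward)
dir-cases horizontal south = inj₂ (inj₂ backward)
dir-cases horizontal east  = inj₁ refl
dir-cases horizontal west  = inj₂ (inj₁ refl)
dir-cases vertical   north = inj₁ refl
dir-cases vertical   south = inj₂ (inj₁ refl)
dir-cases vertical   east  = inj₂ (inj₂ forward)
dir-cases vertical   west  = inj₂ (inj₂ backward)

position-move-perpendicular : ∀ {o d} p → Perpendicular o d → position o (move d p) ≡ position o p
position-move-perpendicular {horizontal} p forward  = refl
position-move-perpendicular {horizontal} p backward = refl
position-move-perpendicular {vertical}   p forward  = refl
position-move-perpendicular {vertical}   p backward = refl

position-edgeTo-perpendicular : ∀ {o d} p → Perpendicular o d → position o (proj₁ (edgeTo p d)) ≡ position o p
position-edgeTo-perpendicular {horizontal} p forward  = refl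
position-edgeTo-perpendicular {horizontal} p backward = refl
position-edgeTo-perpendicular {vertical}   p forward  = refl
position-edgeTo-perpendicular {vertical}   p backward = refl

edgeTo-along≢perpendicular : ∀ {o d} p q → Perpendicular o d → proj₂ (edgeTo p (along o)) ≢ proj₂ (edgeTo q d)
edgeTo-along≢perpendicular {horizontal} p q forward  ()
edgeTo-along≢perpendicular {horizontal} p q backward ()
edgeTo-along≢perpendicular {vertical}   p q forward  ()
edgeTo-along≢perpendicular {vertical}   p q backward ()

position-level-injective : ∀ o {u v} → position o u ≡ position o v → level o u ≡ level o v → u ≡ v
position-level-injective horizontal refl refl = refl
position-level-injective vertical   refl refl = refl

-[a-1]≡-a+1 : ∀ a → ℤ.- (a - + 1) ≡ ℤ.- a + + 1
-[a-1]≡-a+1 = solve-∀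

height : Dir → Point → ℤ
height north (x , y) = y
height south (x , y) = ℤ.- y
height east  (x , y) = x
height west  (x , y) = ℤ.- x

height-move : ∀ d p → height d (move d p) ≡ height d p + + 1
height-move north (x , y) = refl
height-move east  (x , y) = refl
height-move south (x , y) = -[a-1]≡-a+1 y
height-move west  (x , y) = -[a-1]≡-a+1 x

height-perpendicular : ∀ {o d} p q → Perpendicular o d → level o p ≡ level o q → height d p ≡ height d q
height-perpendicular {horizontal} p q forward  eq = eq
height-perpendicular {horizontal} p q backward eq = cong ℤ.-_ eq
height-perpendicular {vertical}   p q forward  eq = eq
height-perpendicular {vertical}   p q backward eq = cong ℤ.-_ eq

neg-InInterval : ∀ {N t} → InInterval N t → InInterval N (ℤ.- t)
neg-InInterval {N} (lo , hi) = ℤP.neg-mono-≤ hi , subst (ℤ.- _ ≤_) (ℤP.neg-involutive (+ N)) (ℤP.neg-mono-≤ lo)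

height-InInterval : ∀ {N} d {x y} → InInterval N x → InInterval N y → InInterval N (height d (x , y))
height-InInterval north _ y∈ = y∈
height-InInterval east  x∈ _ = x∈
height-InInterval south _ y∈ = neg-InInterval y∈
height-InInterval west  x∈ _ = neg-InInterval x∈

march : (Point → Bool) → Dir → ℕ → Point → Point
march P d zero    r = r
march P d (suc k) r = if P (move d r) then march P d k (move d r) else r

march-stops : ∀ P d (Q : Point → Set) B →
  (∀ {r} → Q r → P (move d r) ≡ true → Q (move d r)) → (∀ {r} → Q r → height d r ≤ B) →
  ∀ k {r} → Q r → B < height d r + + k → Q (march P d k r) × P (move d (march P d k r)) ≡ false
march-stops P d Q B Q-step Q-bounded zero {r} q B<h =
  contradiction (Q-bounded q) (ℤP.<⇒≱ (subst (B <_) (ℤP.+-identityʳ (height d r)) B<h))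
march-stops P d Q B Q-step Q-bounded (suc k) {r} q B<h with P (move d r) in next
... | false = q , next
... | true  = march-stops P d Q B Q-step Q-bounded k (Q-step q next) (subst (B <_) shift B<h)
  where
  shift : height d r + + suc k ≡ height d (move d r) + + k
  shift = begin
    height d r + + suc k           ≡⟨ cong (λ n → height d r + n) (ℤP.pos-+ 1 k) ⟩
    height d r + (+ 1 + + k)       ≡⟨ sym (ℤP.+-assoc (height d r) (+ 1) (+ k)) ⟩
    height d r + + 1 + + k         ≡⟨ cong (_+ + k) (sym (height-move d r)) ⟩
    height d (move d r) + + k      ∎
    where open ≡-Reasoning

march-fuel : ∀ {N t} → InInterval N t → + N < t + + suc (N ℕ.+ N)
march-fuel {N} {t} (lo , _) =
  ℤP.<-≤-trans (subst (+ N <_) (sym lowest) (a<a+1 (+ N))) (ℤP.+-monoˡ-≤ (+ suc (N ℕ.+ N)) lo)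
  where
  -n+[1+[n+n]]≡n+1 : ∀ n → ℤ.- n + (+ 1 + (n + n)) ≡ n + + 1
  -n+[1+[n+n]]≡n+1 = solve-∀
  lowest : ℤ.- (+ N) + + suc (N ℕ.+ N) ≡ + N + + 1
  lowest = trans (cong (λ k → ℤ.- (+ N) + (+ 1 + k)) (ℤP.pos-+ N N)) (-n+[1+[n+n]]≡n+1 (+ N))


_∼?_ : (u v : Point) → Dec (u ∼ v)
(a , b) ∼? (c , d) = ((a - c) * (a - c) + (b - d) * (b - d)) ℤ.≟ + 1

bad-edge-booleans : ∀ mp mq rp rq → ((mp ∨ rp) xor (mq ∨ rq)) ∧ not (mp xor mq) ≡ true →
  mp ≡ false × mq ≡ false × (rp xor rq) ≡ true
bad-edge-booleans false false rp    rq eq = refl , refl , trans (sym (∧-identityʳ _)) eq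
bad-edge-booleans true  true  rp    rq ()
bad-edge-booleans true  false rp    true ()
bad-edge-booleans true  false rp    false ()
bad-edge-booleans false true  true  rq ()
bad-edge-booleans false true  false rq ()

module Comparison (M : Point → Bool) (minimal : Minimal M)
  {W : List Point} (cycle : IsLatticeCycle W) (o : Axis) (c : ℤ)
  (line : ∀ {w} → w ∈ W → M w ≡ false → LinePoint W o c w) where

  inRegion : Point → Bool
  inRegion w = does (w ∈? W) ∨ crossingParity w W

  inRegion⇒Region : ∀ {w} → inRegion w ≡ true → Region W w
  inRegion⇒Region {w} eq with w ∈? W
  ... | yes w∈W = inj₁ w∈W
  ... | no  _   = inj₂ eq

  Region⇒inRegion : ∀ {w} → Region W w → inRegion w ≡ true
  Region⇒inRegion {w} w∈R with w ∈? W | w∈R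
  ... | yes _    | _         = refl
  ... | no  w∉W  | inj₁ w∈W  = contradiction w∈W w∉W
  ... | no  _    | inj₂ odd  = odd

  inRegion-false⇒¬Region : ∀ {w} → inRegion w ≡ false → ¬ Region W w
  inRegion-false⇒¬Region w∉ w∈R = contradiction (trans (sym (Region⇒inRegion w∈R)) w∉) λ ()

  ¬Region⇒inRegion : ∀ {w} → ¬ Region W w → inRegion w ≡ false
  ¬Region⇒inRegion {w} w∉R with inRegion w in eq
  ... | false = refl
  ... | true  = contradiction (inRegion⇒Region eq) w∉R

  added : Point → Bool
  added w = not (M w) ∧ inRegion w

  added⇒M : ∀ {w} → added w ≡ true → M w ≡ false
  added⇒M {w} eq with M w
  ... | false = refl
  ... | true  = contradiction eq λ ()

  added⇒Region : ∀ {w} → added w ≡ true → Region W w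
  added⇒Region {w} eq with M w
  ... | false = inRegion⇒Region eq
  ... | true  = contradiction eq λ ()

  M-or-added : ∀ {w} → Region W w → added w ≡ false → M w ≡ true
  M-or-added {w} w∈R eq with M w
  ... | true  = refl
  ... | false = contradiction (trans (sym (Region⇒inRegion w∈R)) eq) λ ()

  U : List Point
  U = square (radius W)

  Region⊆U : ∀ {w} → Region W w → w ∈ U
  Region⊆U = region⊆square cycle

  inClosure : Point → Bool
  inClosure w = does (w ∈? U) ∨ does (any? (w ∼?_) U)

  inClosure⇒∈cl : ∀ {z} → inClosure z ≡ true → z ∈cl U
  inClosure⇒∈cl {z} eq with ∨≡true⇒⊎ {does (z ∈? U)} eq
  ... | inj₁ in-U = inj₁ (does≡true⇒ (z ∈? U) in-U)
  ... | inj₂ near with z ∈? U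
  ...   | yes z∈U = inj₁ z∈U
  ...   | no  z∉U with w , w∈U , z∼w ← find (does≡true⇒ (any? (z ∼?_) U) near) =
    inj₂ (z∉U , w , w∈U , z∼w)

  ∈cl⇒inClosure : ∀ {z} → z ∈cl U → inClosure z ≡ true
  ∈cl⇒inClosure {z} (inj₁ z∈U) rewrite dec-true (z ∈? U) z∈U = refl
  ∈cl⇒inClosure {z} (inj₂ (_ , w , w∈U , z∼w))
    rewrite dec-true (any? (z ∼?_) U) (Any.map (λ { refl → z∼w }) w∈U) = ∨-zeroʳ _

  filled : Point → Bool
  filled w = M w ∨ inRegion w

  -- The competitor K̂ of the minimality condition: M ∪ R, cut off outside Ū.
  K : Point → Bool
  K w = filled w ∧ inClosure w

  K⊆Ū : ∀ z → K z ≡ true → z ∈cl U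
  K⊆Ū z eq with filled z
  ... | true = inClosure⇒∈cl eq

  K-on-Ū : ∀ {z} → z ∈cl U → K z ≡ filled z
  K-on-Ū z∈Ū rewrite ∈cl⇒inClosure z∈Ū = ∧-identityʳ _

  K-on-τ : ∀ z → z ∈τ U → K z ≡ M z
  K-on-τ z z∈τU = begin
    K z                    ≡⟨ K-on-Ū (inj₂ z∈τU) ⟩
    M z ∨ inRegion z       ≡⟨ cong (M z ∨_) (¬Region⇒inRegion (proj₁ z∈τU ∘ Region⊆U)) ⟩
    M z ∨ false            ≡⟨ ∨-identityʳ (M z) ⟩
    M z                    ∎
    where open ≡-Reasoning

  L : List Edge
  L = E U

  ∈-L⁻ : ∀ {e} → e ∈ L → ∃₂ λ w d → w ∈ U × e ≡ edgeTo w d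
  ∈-L⁻ {e} e∈
    with w , w∈U , e∈inc ← find (∈-concatMap⁻ incident (∈-deduplicate⁻ edge-≟ (concatMap incident U) e∈))
    with d , refl ← ∈-incident⁻ w e∈inc = w , d , w∈U , refl

  ∈-L⁺ : ∀ {w} d → w ∈ U → edgeTo w d ∈ L
  ∈-L⁺ {w} d w∈U =
    ∈-deduplicate⁺ edge-≟ (∈-concatMap⁺ incident (Any.map (λ { refl → edgeTo∈incident w d }) w∈U))

  move∈Ū : ∀ {w} d → w ∈ U → move d w ∈cl U
  move∈Ū {w} d w∈U with move d w ∈? U
  ... | yes dw∈U = inj₁ dw∈U
  ... | no  dw∉U = inj₂ (dw∉U , w , w∈U , move-∼ d w)

  endpoints∈Ū : ∀ {e} → e ∈ L → proj₁ (endpoints e) ∈cl U × proj₂ (endpoints e) ∈cl U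
  endpoints∈Ū e∈ with w , d , w∈U , refl ← ∈-L⁻ e∈ with endpoints-edgeTo w d
  ... | inj₁ ends rewrite ends = inj₁ w∈U , move∈Ū d w∈U
  ... | inj₂ ends rewrite ends = move∈Ū d w∈U , inj₁ w∈U

  inBoundary-K : ∀ {e} → e ∈ L → inBoundary K e ≡ flips filled (endpoints e)
  inBoundary-K e∈ = cong₂ _xor_ (K-on-Ū (proj₁ (endpoints∈Ū e∈))) (K-on-Ū (proj₂ (endpoints∈Ū e∈)))

  bad good : Edge → Bool
  bad  e = inBoundary K e ∧ not (inBoundary M e)
  good e = inBoundary M e ∧ not (inBoundary K e)

  good≤bad : count good L ℕ.≤ count bad L
  good≤bad = ℕP.+-cancelˡ-≤ (count (inBoundary M) L) _ _ (begin
    count (inBoundary M) L ℕ.+ count good L  ≤⟨ ℕP.+-monoˡ-≤ (count good L) M≤K ⟩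
    count (inBoundary K) L ℕ.+ count good L  ≡⟨ count-exchange (inBoundary K) (inBoundary M) L ⟩
    count (inBoundary M) L ℕ.+ count bad L   ∎)
    where
    open ℕP.≤-Reasoning
    M≤K : count (inBoundary M) L ℕ.≤ count (inBoundary K) L
    M≤K = proj₂ (proj₂ minimal) U K K⊆Ū K-on-τ

  good-edge : ∀ {r} d → added r ≡ true → Region W (move d r) → M (move d r) ≡ true →
    edgeTo r d ∈ L × good (edgeTo r d) ≡ true
  good-edge {r} d r-added dr∈R dr∈M = ∈-L⁺ d r∈U , is-good
    where
    r∈U = Region⊆U (added⇒Region r-added)
    is-good : good (edgeTo r d) ≡ true
    is-good rewrite inBoundary-edgeTo M r d | inBoundary-edgeTo K r d
                  | K-on-Ū (inj₁ r∈U) | K-on-Ū (move∈Ū d r∈U)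
                  | added⇒M r-added | dr∈M | Region⇒inRegion (added⇒Region r-added) = refl

  inner outer : Point × Point → Point
  inner (p , q) = if filled p then p else q
  outer (p , q) = if filled p then q else p

  inner-outer : ∀ p q → M p ≡ false → M q ≡ false → (inRegion p xor inRegion q) ≡ true →
    added (inner (p , q)) ≡ true × ¬ Region W (outer (p , q)) ×
    ((p , q) ≡ (inner (p , q) , outer (p , q)) ⊎ (p , q) ≡ (outer (p , q) , inner (p , q)))
  inner-outer p q Mp Mq one-inside with xor≡true-cases one-inside
  ... | inj₁ (rp , rq) =
    subst (λ u → added u ≡ true) (sym u≡p) (cong₂ (λ m r → not m ∧ r) Mp rp) ,
    subst (λ v → ¬ Region W v) (sym v≡q) (inRegion-false⇒¬Region rq) ,
    inj₁ (sym (cong₂ _,_ u≡p v≡q))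
    where
    fp : filled p ≡ true
    fp = cong₂ _∨_ Mp rp
    u≡p : inner (p , q) ≡ p
    u≡p = cong (λ b → if b then p else q) fp
    v≡q : outer (p , q) ≡ q
    v≡q = cong (λ b → if b then q else p) fp
  ... | inj₂ (rp , rq) =
    subst (λ u → added u ≡ true) (sym u≡q) (cong₂ (λ m r → not m ∧ r) Mq rq) ,
    subst (λ v → ¬ Region W v) (sym v≡p) (inRegion-false⇒¬Region rp) ,
    inj₂ (sym (cong₂ _,_ v≡p u≡q))
    where
    fp : filled p ≡ false
    fp = cong₂ _∨_ Mp rp
    u≡q : inner (p , q) ≡ q
    u≡q = cong (λ b → if b then p else q) fp
    v≡p : outer (p , q) ≡ p
    v≡p = cong (λ b → if b then q else p) fp

  innerEnd : Edge → Point
  innerEnd e = inner (endpoints e)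

  inward : Point → Dir
  inward u = if inRegion (move (normal o) u) then normal o else opposite (normal o)

  inward-perpendicular : ∀ u → Perpendicular o (inward u)
  inward-perpendicular u with inRegion (move (normal o) u)
  ... | true  = forward
  ... | false = backward

  inward-region : ∀ {u} → LinePoint W o c u → Region W (move (inward u) u)
  inward-region {u} u-line with inRegion (move (normal o) u) in up
  ... | true  = inRegion⇒Region up
  ... | false with LinePoint.normal-neighbour u-line
  ...   | inj₁ above = contradiction (trans (sym (Region⇒inRegion above)) up) λ ()
  ...   | inj₂ below = below

  outward-unique : ∀ {u d} → LinePoint W o c u → Perpendicular o d → ¬ Region W (move d u) →
    d ≡ opposite (inward u)
  outward-unique {u} u-line forward above∉R rewrite ¬Region⇒inRegion above∉R = sym (opposite-involutive (normal o))
  outward-unique {u} u-line backward below∉R with LinePoint.normal-neighbour u-line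
  ... | inj₁ above = cong (λ b → opposite (if b then normal o else opposite (normal o))) (sym (Region⇒inRegion above))
  ... | inj₂ below = contradiction below below∉R

  record BadView (e : Edge) : Set where
    field
      inner-added : added (innerEnd e) ≡ true
      inner-line  : LinePoint W o c (innerEnd e)
      edge≡       : e ≡ edgeTo (innerEnd e) (opposite (inward (innerEnd e)))

  bad-view : ∀ {e} → e ∈ L → bad e ≡ true → BadView e
  bad-view {e} e∈ e-bad = view (inner-outer p q Mp Mq one-inside)
    where
    p q : Point
    p = proj₁ (endpoints e)
    q = proj₂ (endpoints e)
    booleans : M p ≡ false × M q ≡ false × (inRegion p xor inRegion q) ≡ true
    booleans = bad-edge-booleans (M p) (M q) (inRegion p) (inRegion q)
      (subst (λ b → b ∧ not (inBoundary M e) ≡ true) (inBoundary-K e∈) e-bad)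
    Mp = proj₁ booleans
    Mq = proj₁ (proj₂ booleans)
    one-inside = proj₂ (proj₂ booleans)
    u v : Point
    u = inner (p , q)
    v = outer (p , q)
    view : added u ≡ true × ¬ Region W v × ((p , q) ≡ (u , v) ⊎ (p , q) ≡ (v , u)) → BadView e
    view (u-added , v∉R , ends) with edge-seen-from e ends
    ... | d , e≡ , v≡ = record { inner-added = u-added ; inner-line = u-line ; edge≡ = trans e≡ (cong (edgeTo u) d≡) }
      where
      dv∉R : ¬ Region W (move d u)
      dv∉R = subst (λ w → ¬ Region W w) v≡ v∉R
      u∈W : u ∈ W
      u∈W = decidable-stable (u ∈? W) λ u∉W → dv∉R (region-move cycle u∉W (added⇒Region u-added) d)
      u-line : LinePoint W o c u
      u-line = line u∈W (added⇒M u-added)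
      d≡ : d ≡ opposite (inward u)
      d≡ with dir-cases o d
      ... | inj₁ refl        = contradiction (inj₁ (proj₁ (LinePoint.along-neighbours u-line))) dv∉R
      ... | inj₂ (inj₁ refl) = contradiction (inj₁ (proj₂ (LinePoint.along-neighbours u-line))) dv∉R
      ... | inj₂ (inj₂ perp) = outward-unique u-line perp dv∉R

  fuel : ℕ
  fuel = suc (radius W ℕ.+ radius W)

  height-InInterval-radius : ∀ d {r} → Region W r → InInterval (radius W) (height d r)
  height-InInterval-radius d r∈R =
    height-InInterval d (proj₁ (region-bounded cycle r∈R)) (proj₂ (region-bounded cycle r∈R))

  -- A march through R ∖ M ends with a step into M, i.e. across an edge of ∂M ∖ ∂K̂.
  exit : ∀ d (Q : Point → Set) {r₀} → (∀ {r} → Q r → added (move d r) ≡ true → Q (move d r)) →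
    (∀ {r} → Q r → added r ≡ true) → (∀ {r} → Q r → Region W (move d r)) → Q r₀ →
    let r* = march added d fuel r₀ in Q r* × edgeTo r* d ∈ L × good (edgeTo r* d) ≡ true
  exit d Q Q-step Q-added Q-exit q₀
    with q* , stop ← march-stops added d Q (+ radius W) Q-step
                       (λ q → proj₂ (height-InInterval-radius d (added⇒Region (Q-added q)))) fuel q₀
                       (march-fuel (height-InInterval-radius d (added⇒Region (Q-added q₀))))
    = q* , good-edge d (Q-added q*) (Q-exit q*) (M-or-added (Q-exit q*) stop)

  exitPoint : Point → Point
  exitPoint u = march added (inward u) fuel u

  φ : Edge → Edge
  φ e = edgeTo (exitPoint (innerEnd e)) (inward (innerEnd e))

  φ-good : ∀ {e} → BadView e →
    φ e ∈ L × good (φ e) ≡ true × position o (proj₁ (φ e)) ≡ position o (innerEnd e)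
  φ-good {e} view = φ∈L , φ-is-good , trans (position-edgeTo-perpendicular r* (inward-perpendicular u)) r*-position
    where
    open BadView view
    u = innerEnd e
    d = inward u
    Q : Point → Set
    Q r = added r ≡ true × position o r ≡ position o u × (r ≡ u ⊎ height d u < height d r)
    Q-step : ∀ {r} → Q r → added (move d r) ≡ true → Q (move d r)
    Q-step {r} (_ , pos , higher) dr-added =
      dr-added , trans (position-move-perpendicular r (inward-perpendicular u)) pos ,
      inj₂ (subst (height d u <_) (sym (height-move d r)) (climb higher))
      where
      climb : r ≡ u ⊎ height d u < height d r → height d u < height d r + + 1
      climb (inj₁ refl) = a<a+1 (height d u)
      climb (inj₂ lt)   = ℤP.<-trans lt (a<a+1 (height d r))
    Q-exit : ∀ {r} → Q r → Region W (move d r)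
    Q-exit (_ , _ , inj₁ refl) = inward-region inner-line
    Q-exit {r} (r-added , _ , inj₂ lt) = region-move cycle r∉W (added⇒Region r-added) d
      where
      r∉W : r ∉ W
      r∉W r∈W = ℤP.<-irrefl (height-perpendicular u r (inward-perpendicular u)
        (trans (LinePoint.on-line inner-line) (sym (LinePoint.on-line (line r∈W (added⇒M r-added)))))) lt
    r* : Point
    r* = exitPoint u
    result : Q r* × edgeTo r* d ∈ L × good (edgeTo r* d) ≡ true
    result = exit d Q Q-step proj₁ Q-exit (inner-added , refl , inj₁ refl)
    r*-position : position o r* ≡ position o u
    r*-position = proj₁ (proj₂ (proj₁ result))
    φ∈L : φ e ∈ L
    φ∈L = proj₁ (proj₂ result)
    φ-is-good : good (φ e) ≡ true
    φ-is-good = proj₂ (proj₂ result)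

  φ-injective : ∀ {e₁ e₂} → BadView e₁ → BadView e₂ → φ e₁ ≡ φ e₂ → e₁ ≡ e₂
  φ-injective {e₁} {e₂} view₁ view₂ φ≡ = begin
    e₁                                              ≡⟨ BadView.edge≡ view₁ ⟩
    edgeTo u₁ (opposite (inward u₁))                ≡⟨ cong (λ u → edgeTo u (opposite (inward u))) u₁≡u₂ ⟩
    edgeTo u₂ (opposite (inward u₂))                ≡⟨ sym (BadView.edge≡ view₂) ⟩
    e₂                                              ∎
    where
    open ≡-Reasoning
    u₁ = innerEnd e₁
    u₂ = innerEnd e₂
    u₁≡u₂ : u₁ ≡ u₂
    u₁≡u₂ = position-level-injective o
      (trans (sym (proj₂ (proj₂ (φ-good view₁))))
        (trans (cong (position o ∘ proj₁) φ≡) (proj₂ (proj₂ (φ-good view₂)))))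
      (trans (LinePoint.on-line (BadView.inner-line view₁)) (sym (LinePoint.on-line (BadView.inner-line view₂))))

  along-exit : ∀ {r} → added r ≡ true → Region W (move (along o) r)
  along-exit {r} r-added = [ on-curve , off-curve ]′ (toSum (r ∈? W))
    where
    on-curve : r ∈ W → Region W (move (along o) r)
    on-curve r∈W = inj₁ (proj₁ (LinePoint.along-neighbours (line r∈W (added⇒M r-added))))
    off-curve : r ∉ W → Region W (move (along o) r)
    off-curve r∉W = region-move cycle r∉W (added⇒Region r-added) (along o)

  BadList GoodList : List Edge
  BadList  = filter (λ e → T? (bad e)) L
  GoodList = filter (λ e → T? (good e)) L

  ∈-BadList⁻ : ∀ {e} → e ∈ BadList → BadView e
  ∈-BadList⁻ e∈ = bad-view (proj₁ e∈L×bad) (Equivalence.to T-≡ (proj₂ e∈L×bad))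
    where e∈L×bad = ∈-filter⁻ (λ e → T? (bad e)) e∈

  ∈-GoodList⁺ : ∀ {e} → e ∈ L → good e ≡ true → e ∈ GoodList
  ∈-GoodList⁺ e∈ e-good = ∈-filter⁺ (λ e → T? (good e)) e∈ (Equivalence.from T-≡ e-good)

  φ-BadList⊆GoodList : ∀ {e} → e ∈ BadList → φ e ∈ GoodList
  φ-BadList⊆GoodList {e} e∈ = ∈-GoodList⁺ (proj₁ φ-facts) (proj₁ (proj₂ φ-facts))
    where φ-facts = φ-good {e} (∈-BadList⁻ e∈)

  φ≢along : ∀ e r → φ e ≢ edgeTo r (along o)
  φ≢along e r φ≡ = edgeTo-along≢perpendicular r (exitPoint (innerEnd e)) (inward-perpendicular (innerEnd e))
    (cong proj₂ (sym φ≡))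

  BadList-unique : Unique BadList
  BadList-unique = Unique.filter⁺ (λ e → T? (bad e)) (deduplicate-! (concatMap incident U))

  φ-injective-on : ∀ {e₁ e₂} → e₁ ∈ BadList → e₂ ∈ BadList → φ e₁ ≡ φ e₂ → e₁ ≡ e₂
  φ-injective-on {e₁} {e₂} e₁∈ e₂∈ = φ-injective {e₁} {e₂} (∈-BadList⁻ e₁∈) (∈-BadList⁻ e₂∈)

  module _ {z} (z∈R : Region W z) (Mz : M z ≡ false) where

    r₀ : Point
    r₀ = march added (along o) fuel z

    g₀ : Edge
    g₀ = edgeTo r₀ (along o)

    g₀-exit : added r₀ ≡ true × g₀ ∈ L × good g₀ ≡ true
    g₀-exit = exit (along o) (λ r → added r ≡ true) (λ _ next → next) (λ r-added → r-added) along-exit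
                (cong₂ (λ m r → not m ∧ r) Mz (Region⇒inRegion z∈R))

    g₀∈GoodList : g₀ ∈ GoodList
    g₀∈GoodList = ∈-GoodList⁺ (proj₁ (proj₂ g₀-exit)) (proj₂ (proj₂ g₀-exit))

    bad<good : count bad L ℕ.< count good L
    bad<good =
      length-<-injection φ {BadList} {GoodList} {g₀}
        BadList-unique
        φ-BadList⊆GoodList
        φ-injective-on
        g₀∈GoodList
        (λ {e} _ → φ≢along e r₀)

  region⊆M : ∀ {z} → Region W z → M z ≡ true
  region⊆M {z} z∈R with M z in Mz
  ... | true  = refl
  ... | false = contradiction good≤bad (ℕP.<⇒≱ (bad<good z∈R Mz))

lemma3p4 : (M : Point → Bool) → Minimal M →
    (m : ℕ) (x : Fin (suc m) → Point) →
    (∀ (i : Fin m) → x (inject₁ i) ∼ x (fsuc i)) →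
    Injective _≡_ _≡_ x →
    x zero ≢ x (fromℕ m) →
    (∀ i → M (x i) ≡ true) →
    (s : Side) (c : ℤ) →
    (∀ i → + 0 ≤ offset s c (x i)) →
    offset s c (x zero) ≡ + 0 →
    offset s c (x (fromℕ m)) ≡ + 0 →
    ∀ z → Enclosed s c m x z → M z ≡ true
lemma3p4 M minimal zero    x _          _ x₀≢xₘ _   _ _ _ _        _        _ _        =
  contradiction refl x₀≢xₘ
lemma3p4 M minimal (suc n) x x-adjacent _ x₀≢xₘ x∈M s c _ x₀-on-ℓ xₘ-on-ℓ z z∈region =
  Comparison.region⊆M M minimal cycle o c outside-M-on-line z∈region
  where
  open Curve x x-adjacent s c x₀-on-ℓ xₘ-on-ℓ x₀≢xₘ
  path⊆M : ∀ {w} → w ∈ path → M w ≡ true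
  path⊆M w∈path with i , w≡ ← ∈-tabulate⁻ {f = x} w∈path = trans (cong M w≡) (x∈M i)
  outside-M-on-line : ∀ {w} → w ∈ W → M w ≡ false → LinePoint W o c w
  outside-M-on-line w∈W Mw = curve-LinePoint w∈W λ w∈path → contradiction (trans (sym (path⊆M w∈path)) Mw) λ ()
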